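{- For every integer $n\geq 1$, there is a bijection between the set $Q_n$ and the set $T_n$ (defined below).
   Context: A doubly rooted tree on a finite set $S$ is a labeled (unrooted) tree with vertex set $S$ together with an ordered pair of distinguished vertices $(r_1,r_2)$, called the first and second root, which need not be distinct. A triply rooted tree on $S$ is a labeled tree with vertex set $S$ together with an ordered triple of distinguished vertices $(r_1,r_2,r_3)$ (first, second, third root), not necessarily distinct. Let $T_n$ be the set of triply rooted trees on $[n]=\{1,\dots,n\}$. A triple $(X,Y,Z)$ of subsets of $[n]$ is a composition of $[n]$ if $X,Y,Z$ are pairwise disjoint and $X\cup Y\cup Z=[n]$ (some of them may be empty). Let $Q_n$ be the set of triples $(D,D',D'')$ where $(X,Y,Z)$ is a composition of $[n]$ with $X\neq\emptyset$, $D$ is a doubly rooted tree on $X$, $D'$ is a doubly rooted tree on $Y$ (or $D'=\emptyset$ if $Y=\emptyset$), and $D''$ is a doubly rooted tree on $Z$ (or $D''=\emptyset$ if $Z=\emptyset$). -}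

module Defs where

open import Data.Nat using (ℕ; _≤_; _+_)
open import Data.Fin using (Fin)
open import Data.Bool using (Bool; true)
open import Data.Vec using (Vec; lookup)
open import Data.List using (List; []; _∷_; length; _++_)
open import Data.List.Relation.Unary.Unique.Propositional using (Unique)
open import Data.Product using (_×_; ∃)
open import Data.Unit using () renaming (⊤ to Unit)
open import Relation.Nullary using (¬_)
open import Relation.Binary.PropositionalEquality using (_≡_)
open import Data.Fin.Subset using (Subset; _∈_; _∩_; _∪_; Nonempty)
  renaming (⊤ to FullSet; ⊥ to EmptySet)

Adj : ℕ → Set
Adj n = Vec (Vec Bool n) n

_∼[_]_ : {n : ℕ} → Fin n → Adj n → Fin n → Set
i ∼[ A ] j = lookup (lookup A i) j ≡ true

data Walk {n : ℕ} (A : Adj n) : Fin n → Fin n → Set where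
  stop : ∀ {i} → Walk A i i
  step : ∀ {i j k} → i ∼[ A ] j → Walk A j k → Walk A i k

Chain : {n : ℕ} → Adj n → List (Fin n) → Set
Chain A [] = Unit
Chain A (x ∷ []) = Unit
Chain A (x ∷ y ∷ xs) = (x ∼[ A ] y) × Chain A (y ∷ xs)

-- a cycle x₀ x₁ … x_k x₀ with k ≥ 2 (at least 3 vertices), the xᵢ pairwise
-- distinct, consecutive ones adjacent and x_k adjacent to x₀
HasCycle : {n : ℕ} → Adj n → Set
HasCycle {n} A = ∃ λ (x : Fin n) → ∃ λ (xs : List (Fin n)) →
  (2 ≤ length xs) × Unique (x ∷ xs) × Chain A (x ∷ (xs ++ (x ∷ [])))

record IsTree {n : ℕ} (S : Subset n) (A : Adj n) : Set where
  field
    symmetric   : ∀ i j → i ∼[ A ] j → j ∼[ A ] i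
    loopless    : ∀ i → ¬ (i ∼[ A ] i)
    edgesInS    : ∀ i j → i ∼[ A ] j → (i ∈ S) × (j ∈ S)
    nonempty    : Nonempty S
    connected   : ∀ i j → i ∈ S → j ∈ S → Walk A i j
    acyclic     : ¬ HasCycle A

record DRTree (n : ℕ) (S : Subset n) : Set where
  field
    edges   : Adj n
    .isTree : IsTree S edges
    root₁   : Fin n
    root₂   : Fin n
    .root₁∈ : root₁ ∈ S
    .root₂∈ : root₂ ∈ S

data DRTree? (n : ℕ) (S : Subset n) : Set where
  empty : .(S ≡ EmptySet) → DRTree? n S
  tree  : DRTree n S → DRTree? n S

record TRTree (n : ℕ) : Set where
  field
    edges   : Adj n
    .isTree : IsTree FullSet edges
    root₁   : Fin n
    root₂   : Fin n
    root₃   : Fin n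

record QTriple (n : ℕ) : Set where
  field
    X Y Z  : Subset n
    .disjXY : X ∩ Y ≡ EmptySet
    .disjXZ : X ∩ Z ≡ EmptySet
    .disjYZ : Y ∩ Z ≡ EmptySet
    .cover  : X ∪ (Y ∪ Z) ≡ FullSet
    .Xne    : Nonempty X
    D   : DRTree n X
    D′  : DRTree? n Y
    D″  : DRTree? n Z

module Submission where

-- cut : T_n → Q_n cuts a tree with roots r1, r2, r3 at the median v of the
-- roots, the unique vertex such that no two roots other than v are joined by a
-- path avoiding v.  Y and Z are the branches of v containing r1 and r2 (empty
-- if the root is v itself) and X is the rest, which contains v and r3.  D is
-- the tree induced on X rooted at (v, r3), D′ the tree on Y rooted at r1 and
-- the neighbour of v in Y, D″ the tree on Z rooted at the neighbour of v in Z
-- and r2.  glue : Q_n → T_n reconnects D′ and D″ to the first root of D by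
-- one edge each, and both composites are identities.

open import Defs
open import Data.Nat using (ℕ; zero; suc; _≤_; _<_; z≤n; s≤s; _+_)
import Data.Nat.Properties as ℕP
open import Data.Fin as F using (Fin; zero; suc; _≟_)
import Data.Fin.Properties as FP
open import Data.Fin.Subset using (Subset; _∈_; _∩_; _∪_; Nonempty) renaming (⊤ to FullSet; ⊥ to EmptySet)
import Data.Fin.Subset.Properties as SSP
open import Data.Bool as B using (Bool; true; false; _∧_; _∨_; not; if_then_else_)
import Data.Bool.Properties as BP
open import Data.Vec using (Vec; []; _∷_; lookup; tabulate)
import Data.Vec.Properties as VP
open import Data.List using (List; []; _∷_; length; _++_)
open import Data.List.Membership.Propositional using () renaming (_∈_ to _∈ₗ_)
import Data.List.Membership.DecPropositional as DMem
open import Data.List.Relation.Unary.Any using (here; there)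
open import Data.List.Relation.Unary.Unique.Propositional using (Unique)
open import Data.List.Relation.Unary.AllPairs using ([]; _∷_)
open import Data.List.Relation.Unary.All as All using (All; []; _∷_)
open import Data.List.Relation.Unary.All.Properties using (¬Any⇒All¬)
open import Data.Product
open import Data.Sum
open import Data.Empty
open import Data.Unit using (⊤; tt)
open import Relation.Nullary
open import Relation.Binary.PropositionalEquality
open import Function.Bundles using (_⤖_; mk↔ₛ′)
open import Function.Properties.Inverse using (↔⇒⤖)

∧-elim : ∀ {a b} → a ∧ b ≡ true → a ≡ true × b ≡ true
∧-elim {true} {true} refl = refl , refl

∧-intro : ∀ {a b} → a ≡ true → b ≡ true → a ∧ b ≡ true
∧-intro refl refl = refl

∨-elim : ∀ {a b} → a ∨ b ≡ true → a ≡ true ⊎ b ≡ true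
∨-elim {true} _ = inj₁ refl
∨-elim {false} e = inj₂ e

∨-introˡ : ∀ {a b} → a ≡ true → a ∨ b ≡ true
∨-introˡ refl = refl

∨-introʳ : ∀ {a b} → b ≡ true → a ∨ b ≡ true
∨-introʳ {true} _ = refl
∨-introʳ {false} e = e

isYes⇒ : ∀ {a} {A : Set a} (d : Dec A) → ⌊ d ⌋ ≡ true → A
isYes⇒ (yes a) _ = a

⇒isYes : ∀ {a} {A : Set a} (d : Dec A) → A → ⌊ d ⌋ ≡ true
⇒isYes (yes _) _ = refl
⇒isYes (no na) a = ⊥-elim (na a)

isNo⇒ : ∀ {a} {A : Set a} (d : Dec A) → not ⌊ d ⌋ ≡ true → ¬ A
isNo⇒ (no na) _ = na

⇒isNo : ∀ {a} {A : Set a} (d : Dec A) → ¬ A → not ⌊ d ⌋ ≡ true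
⇒isNo (no _) _ = refl
⇒isNo (yes a) na = ⊥-elim (na a)

false≢true : false ≢ true
false≢true ()

not-true⇒ : ∀ {a} → not a ≡ true → a ≢ true
not-true⇒ {false} _ ()

⇒not-true : ∀ {a} → a ≢ true → not a ≡ true
⇒not-true {false} _ = refl
⇒not-true {true} h = ⊥-elim (h refl)

Graph : ℕ → Set
Graph n = Fin n → Fin n → Bool

-- Edge g i j is the proposition g i j ≡ true, wrapped in a record so that g
-- is recoverable from the type and can be inferred.
record Edge {n} (g : Graph n) (i j : Fin n) : Set where
  constructor ⟨_⟩
  field holds : g i j ≡ true

open Edge public

-- Paths in a graph (walks, possibly with repeated vertices).
data Path {n} (g : Graph n) : Fin n → Fin n → Set where
  stop : ∀ {i} → Path g i i
  step : ∀ {i j k} → Edge g i j → Path g j k → Path g i k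

module _ {n : ℕ} where

  _++ₚ_ : ∀ {g : Graph n} {i j k} → Path g i j → Path g j k → Path g i k
  stop ++ₚ w = w
  step e v ++ₚ w = step e (v ++ₚ w)

  Symmetric : Graph n → Set
  Symmetric g = ∀ {i j} → Edge g i j → Edge g j i

  reversePath : ∀ {g : Graph n} → Symmetric g → ∀ {i j} → Path g i j → Path g j i
  reversePath s stop = stop
  reversePath s (step e w) = reversePath s w ++ₚ step (s e) stop

  edgePath : ∀ {g : Graph n} {i j} → Edge g i j → Path g i j
  edgePath e = step e stop

  mapPath : ∀ {g h : Graph n} (f : Fin n → Fin n) →
         (∀ {y z} → Edge g y z → f y ≡ f z ⊎ Edge h (f y) (f z)) →
         ∀ {a b} → Path g a b → Path h (f a) (f b)
  mapPath f hf stop = stop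
  mapPath f hf (step e w) with hf e
  ... | inj₁ eq rewrite eq = mapPath f hf w
  ... | inj₂ e' = step e' (mapPath f hf w)

  weakenPath : ∀ {g h : Graph n} → (∀ {y z} → Edge g y z → Edge h y z) → ∀ {a b} → Path g a b → Path h a b
  weakenPath hf stop = stop
  weakenPath hf (step e w) = step (hf e) (weakenPath hf w)

  transferPath : ∀ {g h : Graph n} {Q : Fin n → Set} {b} →
             (∀ {y z} → Edge g y z → Q y → Q z → Edge h y z) →
             (∀ {y} → Path g y b → Q y) → ∀ {a} → Path g a b → Path h a b
  transferPath hf q stop = stop
  transferPath hf q (step e w) = step (hf e (q (step e w)) (q w)) (transferPath hf q w)

  carryPath : ∀ {g h : Graph n} (Q : Fin n → Set) →
        (∀ {y z} → Edge g y z → Q y → Q z × Edge h y z) →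
        ∀ {a b} → Q a → Path g a b → Path h a b × Q b
  carryPath Q hf qa stop = stop , qa
  carryPath Q hf qa (step e w) with hf e qa
  ... | qz , e' with carryPath Q hf qz w
  ... | w' , qb = step e' w' , qb

  abstract
    -- The graph with all edges at v removed; kept abstract so that only its
    -- introduction and elimination rules are used.
    delete : Graph n → Fin n → Graph n
    delete g v i j = g i j ∧ (not ⌊ i ≟ v ⌋ ∧ not ⌊ j ≟ v ⌋)

    delete-elim : ∀ {g v i j} → Edge (delete g v) i j → Edge g i j × i ≢ v × j ≢ v
    delete-elim {g} {v} {i} {j} ⟨ e ⟩ with ∧-elim {g i j} e
    ... | e1 , e2 with ∧-elim {not ⌊ i ≟ v ⌋} e2
    ... | e3 , e4 = ⟨ e1 ⟩ , isNo⇒ (i ≟ v) e3 , isNo⇒ (j ≟ v) e4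

    delete-intro : ∀ {g v i j} → Edge g i j → i ≢ v → j ≢ v → Edge (delete g v) i j
    delete-intro {g} {v} {i} {j} ⟨ e ⟩ a b = ⟨ ∧-intro e (∧-intro (⇒isNo (i ≟ v) a) (⇒isNo (j ≟ v) b)) ⟩

  delete-symmetric : ∀ {g} → Symmetric g → ∀ {v} → Symmetric (delete g v)
  delete-symmetric s e with delete-elim e
  ... | e1 , a , b = delete-intro (s e1) b a

  delete-⊆ : ∀ {g v i j} → Edge (delete g v) i j → Edge g i j
  delete-⊆ e = proj₁ (delete-elim e)

  vertices : ∀ {g : Graph n} {i j} → Path g i j → List (Fin n)
  vertices {i = i} stop = i ∷ []
  vertices {i = i} (step _ w) = i ∷ vertices w

  pathLength : ∀ {g : Graph n} {i j} → Path g i j → ℕ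
  pathLength stop = 0
  pathLength (step _ w) = suc (pathLength w)

  length-vertices : ∀ {g : Graph n} {i j} (w : Path g i j) → length (vertices w) ≡ suc (pathLength w)
  length-vertices stop = refl
  length-vertices (step _ w) = cong suc (length-vertices w)

  dropUntil : ∀ {g : Graph n} {a b x} (w : Path g a b) → x ∈ₗ vertices w → Unique (vertices w) →
           Σ (Path g x b) (λ w' → Unique (vertices w'))
  dropUntil stop (here refl) u = stop , u
  dropUntil (step e w) (here refl) u = step e w , u
  dropUntil (step e w) (there m) (_ ∷ u) = dropUntil w m u

  simplify : ∀ {g : Graph n} {a b} → Path g a b → Σ (Path g a b) (λ w' → Unique (vertices w'))
  simplify stop = stop , ([] ∷ [])
  simplify {a = a} (step e w) with simplify w
  ... | w' , u with DMem._∈?_ _≟_ a (vertices w')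
  ... | yes m = dropUntil w' m u
  ... | no nm = step e w' , (¬Any⇒All¬ (vertices w') nm ∷ u)

punchOutAll : ∀ {m} (x : Fin (suc m)) (ys : List (Fin (suc m))) → All (x ≢_) ys → List (Fin m)
punchOutAll x [] [] = []
punchOutAll x (y ∷ ys) (p ∷ ps) = F.punchOut p ∷ punchOutAll x ys ps

punchOutAll-length : ∀ {m} (x : Fin (suc m)) ys ps → length (punchOutAll {m} x ys ps) ≡ length ys
punchOutAll-length x [] [] = refl
punchOutAll-length x (y ∷ ys) (p ∷ ps) = cong suc (punchOutAll-length x ys ps)

punchOutAll-fresh : ∀ {m} {x y : Fin (suc m)} (pa : x ≢ y) ys ps → All (y ≢_) ys →
         All (F.punchOut pa ≢_) (punchOutAll x ys ps)
punchOutAll-fresh pa [] [] [] = []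
punchOutAll-fresh pa (z ∷ ys) (q ∷ ps) (r ∷ rs) = (λ eq → r (FP.punchOut-injective pa q eq)) ∷ punchOutAll-fresh pa ys ps rs

punchOutAll-unique : ∀ {m} (x : Fin (suc m)) ys ps → Unique ys → Unique (punchOutAll x ys ps)
punchOutAll-unique x [] [] [] = []
punchOutAll-unique x (y ∷ ys) (p ∷ ps) (a ∷ u) = punchOutAll-fresh p ys ps a ∷ punchOutAll-unique x ys ps u

unique⇒length≤ : ∀ {n} (xs : List (Fin n)) → Unique xs → length xs ≤ n
unique⇒length≤ {zero} [] _ = z≤n
unique⇒length≤ {zero} (() ∷ _) _
unique⇒length≤ {suc m} [] _ = z≤n
unique⇒length≤ {suc m} (x ∷ xs) (a ∷ u) =
  s≤s (subst (_≤ m) (punchOutAll-length x xs a) (unique⇒length≤ (punchOutAll x xs a) (punchOutAll-unique x xs a u)))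

-- Paths of at most k steps; for fixed k their existence is decidable by
-- recursion on k, trying every first step.
data BPath {n} (g : Graph n) : ℕ → Fin n → Fin n → Set where
  bstop : ∀ {k i} → BPath g k i i
  bstep : ∀ {k i j l} → Edge g i j → BPath g k j l → BPath g (suc k) i l

module _ {n : ℕ} where
  bpath? : ∀ (g : Graph n) k i j → Dec (BPath g k i j)
  bpath? g zero i j with i ≟ j
  ... | yes refl = yes bstop
  ... | no ne = no λ { bstop → ne refl }
  bpath? g (suc k) i j with i ≟ j
  ... | yes refl = yes bstop
  ... | no ne with FP.any? (λ m → (g i m B.≟ true) ×-dec bpath? g k m j)
  ... | yes (m , e , w) = yes (bstep ⟨ e ⟩ w)
  ... | no nf = no λ { bstop → ne refl ; (bstep ⟨ e ⟩ w) → nf (_ , e , w) }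

  forgetBound : ∀ {g : Graph n} {k i j} → BPath g k i j → Path g i j
  forgetBound bstop = stop
  forgetBound (bstep e w) = step e (forgetBound w)

  bpath-mono : ∀ {g : Graph n} {k k' i j} → k ≤ k' → BPath g k i j → BPath g k' i j
  bpath-mono _ bstop = bstop
  bpath-mono (s≤s le) (bstep e w) = bstep e (bpath-mono le w)

  exactBound : ∀ {g : Graph n} {i j} (w : Path g i j) → BPath g (pathLength w) i j
  exactBound stop = bstop
  exactBound (step e w) = bstep e (exactBound w)

  -- Since simple paths visit at most n vertices, any path can be replaced by
  -- one with at most n steps.
  boundBySize : ∀ {g : Graph n} {i j} → Path g i j → BPath g n i j
  boundBySize w with simplify w
  ... | w' , u = bpath-mono le (exactBound w')
    where
      le : pathLength w' ≤ n
      le = ℕP.≤-trans (ℕP.n≤1+n _) (subst (_≤ n) (length-vertices w') (unique⇒length≤ (vertices w') u))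

  abstract
    -- Reachability is decidable.  Abstract, so that typechecking never unfolds it.
    path? : ∀ (g : Graph n) i j → Dec (Path g i j)
    path? g i j = map′ forgetBound boundBySize (bpath? g n i j)

-- A tree on the vertex set S: symmetric, loopless, edges inside S, S
-- connected, and without bypasses: two distinct neighbours u, w of a vertex v
-- are never joined by a path avoiding v.  For graphs this is equivalent to
-- acyclicity (see Cycles below) and is the form used throughout.
record TreeOn {n} (S : Fin n → Set) (g : Graph n) : Set where
  field
    symm     : Symmetric g
    irrefl   : ∀ {i} → ¬ Edge g i i
    edgeInS  : ∀ {i j} → Edge g i j → S i
    connect  : ∀ {i j} → S i → S j → Path g i j
    noBypass : ∀ {v u w} → Edge g v u → Edge g v w → u ≢ w → ¬ Path (delete g v) u w

module _ {n : ℕ} where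

  leaveVertex : ∀ {g : Graph n} {v a x} → Path g a x → x ≢ v →
       (a ≢ v × Path (delete g v) a x) ⊎ ∃ λ u → Edge g v u × Path (delete g v) u x
  leaveVertex stop ne = inj₁ (ne , stop)
  leaveVertex {v = v} {a = a} (step e w) ne with leaveVertex w ne
  ... | inj₂ r = inj₂ r
  ... | inj₁ (zv , w') with a ≟ v
  ... | yes refl = inj₂ (_ , e , w')
  ... | no av = inj₁ (av , step (delete-intro e av zv) w')

module Branches {n : ℕ} (g : Graph n) where
  InBranch : Fin n → Fin n → Fin n → Set
  InBranch v u x = x ≢ v × Path (delete g v) x u

  inBranch? : ∀ v u x → Dec (InBranch v u x)
  inBranch? v u x with x ≟ v | path? (delete g v) x u
  ... | yes e | _ = no (λ p → proj₁ p e)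
  ... | no ne | yes w = yes (ne , w)
  ... | no ne | no nw = no (λ p → nw (proj₂ p))

module TreeFacts {n : ℕ} {S : Fin n → Set} {g : Graph n} (T : TreeOn S g) where
  open TreeOn T
  open Branches g public

  delete-symm : ∀ {v} → Symmetric (delete g v)
  delete-symm = delete-symmetric symm

  branchOf : ∀ {v x} → S v → S x → x ≢ v → ∃ λ u → Edge g v u × Path (delete g v) u x
  branchOf sv sx ne with leaveVertex (connect sv sx) ne
  ... | inj₁ (vv , _) = ⊥-elim (vv refl)
  ... | inj₂ r = r

  branchNeighbour-unique : ∀ {v p d x} → Edge g v p → Edge g v d → Path (delete g v) p x → Path (delete g v) d x → p ≡ d
  branchNeighbour-unique {p = p} {d} ep ed wp wd with p ≟ d
  ... | yes eq = eq
  ... | no ne = ⊥-elim (noBypass ep ed ne (wp ++ₚ reversePath delete-symm wd))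

  edge⇒≢ : ∀ {i j} → Edge g i j → i ≢ j
  edge⇒≢ e refl = irrefl e

  delete-delete : ∀ {v u i j} → Edge (delete (delete g v) u) i j → Edge (delete g u) i j
  delete-delete {v} {u} e with delete-elim {g = delete g v} {v = u} e
  ... | e1 , a , b = delete-intro {g = g} {v = u} (delete-⊆ {g = g} {v = v} e1) a b

  facingBranches-disjoint : ∀ {v u x} → Edge g v u → InBranch v u x → InBranch u v x → ⊥
  facingBranches-disjoint {v} {u} {x} evu (xv , w1) (xu , w2) with leaveVertex (reversePath delete-symm w1) xu
  ... | inj₁ (uu , _) = uu refl
  ... | inj₂ (u₁ , e₁ , w₁) with delete-elim e₁
  ... | e₁' , _ , u₁v = noBypass e₁' (symm evu) u₁v (weakenPath delete-delete w₁ ++ₚ w2)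

  subBranch : ∀ {v u u'} → Edge g v u → Edge g u u' → u' ≢ v → ∀ {x} → InBranch u u' x → InBranch v u x
  subBranch {v} {u} {u'} evu euu' u'v {x} (xu , w) = q w , (w' ++ₚ edgePath (delete-intro (symm euu') u'v uv))
    where
      uv : u ≢ v
      uv eq = edge⇒≢ evu (sym eq)
      q : ∀ {y} → Path (delete g u) y u' → y ≢ v
      q wy refl = noBypass (symm evu) euu' (λ e → u'v (sym e)) wy
      w' : Path (delete g v) x u'
      w' = transferPath (λ e qy qz → delete-intro {g = g} {v = v} (delete-⊆ {g = g} {v = u} e) qy qz) q w

-- Number of elements of Fin n satisfying a Boolean predicate; strictly
-- monotone under strict inclusion.  Used as the termination measure of the
-- descent towards the median.
countTrue : ∀ {n} → (Fin n → Bool) → ℕ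
countTrue {zero} f = 0
countTrue {suc n} f = (if f zero then 1 else 0) + countTrue (λ i → f (suc i))

countTrue≤ : ∀ {n} (f : Fin n → Bool) → countTrue f ≤ n
countTrue≤ {zero} f = z≤n
countTrue≤ {suc n} f with f zero
... | true = s≤s (countTrue≤ (λ i → f (suc i)))
... | false = ℕP.m≤n⇒m≤1+n (countTrue≤ (λ i → f (suc i)))

countTrue-mono : ∀ {n} (f h : Fin n → Bool) → (∀ x → f x ≡ true → h x ≡ true) → countTrue f ≤ countTrue h
countTrue-mono {zero} f h sub = z≤n
countTrue-mono {suc n} f h sub with f zero in ef | h zero in eh
... | true | true = s≤s (countTrue-mono _ _ (λ x → sub (suc x)))
... | true | false = ⊥-elim (false≢true (trans (sym eh) (sub zero ef)))
... | false | true = ℕP.m≤n⇒m≤1+n (countTrue-mono _ _ (λ x → sub (suc x)))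
... | false | false = countTrue-mono _ _ (λ x → sub (suc x))

countTrue-< : ∀ {n} (f h : Fin n → Bool) → (∀ x → f x ≡ true → h x ≡ true) →
          ∀ y → h y ≡ true → f y ≢ true → countTrue f < countTrue h
countTrue-< {suc n} f h sub zero hy fy with f zero in ef | h zero
... | true | _ = ⊥-elim (fy refl)
... | false | true = s≤s (countTrue-mono _ _ (λ x → sub (suc x)))
... | false | false = ⊥-elim (false≢true hy)
countTrue-< {suc n} f h sub (suc y) hy fy with f zero in ef | h zero in eh
... | true | true = s≤s (countTrue-< _ _ (λ x → sub (suc x)) y hy fy)
... | true | false = ⊥-elim (false≢true (trans (sym eh) (sub zero ef)))
... | false | true = ℕP.m≤n⇒m≤1+n (countTrue-< _ _ (λ x → sub (suc x)) y hy fy)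
... | false | false = countTrue-< _ _ (λ x → sub (suc x)) y hy fy

PairsMeet : Set
PairsMeet = ∀ (i j k l : Fin 3) → i ≢ j → k ≢ l → ∃ λ t → (t ≡ i ⊎ t ≡ j) × (t ≡ k ⊎ t ≡ l)

pairsMeet? : Dec PairsMeet
pairsMeet? = FP.all? λ i → FP.all? λ j → FP.all? λ k → FP.all? λ l →
  ¬? (i ≟ j) →-dec (¬? (k ≟ l) →-dec
    FP.any? λ t → ((t ≟ i) ⊎-dec (t ≟ j)) ×-dec ((t ≟ k) ⊎-dec (t ≟ l)))

pairsMeet : PairsMeet
pairsMeet = from-yes pairsMeet?

pigeonhole3 : ∀ {P Q : Fin 3 → Set} → (∀ t → P t ⊎ Q t) →
          (∃₂ λ i j → i ≢ j × P i × P j) ⊎ (∃₂ λ i j → i ≢ j × Q i × Q j)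
pigeonhole3 f with f zero | f (suc zero) | f (suc (suc zero))
... | inj₁ a | inj₁ b | _ = inj₁ (_ , _ , (λ ()) , a , b)
... | inj₂ a | inj₂ b | _ = inj₂ (_ , _ , (λ ()) , a , b)
... | inj₁ a | inj₂ b | inj₁ c = inj₁ (_ , _ , (λ ()) , a , c)
... | inj₁ a | inj₂ b | inj₂ c = inj₂ (_ , _ , (λ ()) , b , c)
... | inj₂ a | inj₁ b | inj₁ c = inj₁ (_ , _ , (λ ()) , b , c)
... | inj₂ a | inj₁ b | inj₂ c = inj₂ (_ , _ , (λ ()) , a , c)

module MedianDef {n : ℕ} (g : Graph n) (ρ : Fin 3 → Fin n) where

  Separates : Fin n → Fin 3 → Fin 3 → Set
  Separates v i j = i ≢ j → ρ i ≡ v ⊎ ρ j ≡ v ⊎ ¬ Path (delete g v) (ρ i) (ρ j)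

  separates? : ∀ v i j → Dec (Separates v i j)
  separates? v i j = ¬? (i ≟ j) →-dec ((ρ i ≟ v) ⊎-dec ((ρ j ≟ v) ⊎-dec ¬? (path? (delete g v) (ρ i) (ρ j))))

  IsMedian : Fin n → Set
  IsMedian v = ∀ i j → Separates v i j

  isMedian? : ∀ v → Dec (IsMedian v)
  isMedian? v = FP.all? λ i → FP.all? (separates? v i)

  ¬median⇒joinedPair : ∀ {v} → ¬ IsMedian v → ∃₂ λ i j → i ≢ j × ρ i ≢ v × ρ j ≢ v × Path (delete g v) (ρ i) (ρ j)
  ¬median⇒joinedPair {v} nm with FP.¬∀⟶∃¬ 3 _ (λ i → FP.all? (separates? v i)) nm
  ... | i , ni with FP.¬∀⟶∃¬ 3 _ (separates? v i) ni
  ... | j , nj with i ≟ j | ρ i ≟ v | ρ j ≟ v | path? (delete g v) (ρ i) (ρ j)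
  ... | yes ij | _ | _ | _ = ⊥-elim (nj (λ ne → ⊥-elim (ne ij)))
  ... | no ij | yes a | _ | _ = ⊥-elim (nj (λ _ → inj₁ a))
  ... | no ij | no a | yes b | _ = ⊥-elim (nj (λ _ → inj₂ (inj₁ b)))
  ... | no ij | no a | no b | no w = ⊥-elim (nj (λ _ → inj₂ (inj₂ w)))
  ... | no ij | no a | no b | yes w = i , j , ij , a , b , w

module MedianFacts {n : ℕ} {g : Graph n} (T : TreeOn (λ _ → ⊤) g) (ρ : Fin 3 → Fin n) where
  open TreeOn T
  open TreeFacts T
  open MedianDef g ρ public

  -- Invariant of the descent: an edge v—u whose branch towards u contains
  -- two distinct roots.
  DescentState : Fin n → Fin n → Set
  DescentState v u = Edge g v u × ∃₂ λ i j → i ≢ j × InBranch v u (ρ i) × InBranch v u (ρ j)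

  inBranchᵇ : Fin n → Fin n → Fin n → Bool
  inBranchᵇ v u x = ⌊ inBranch? v u x ⌋

  -- Walk towards u until a median is found.  If u is not a median, two roots
  -- k, l are joined avoiding u; they lie in a branch u—u′, and u′ ≠ v because
  -- the two branches at the edge v—u are disjoint and two pairs of roots meet.
  -- The branch of u towards u′ is strictly smaller than that of v towards u.
  descend : ∀ m v u → countTrue (inBranchᵇ v u) < m → DescentState v u → ∃ IsMedian
  descend (suc m) v u lt (evu , i , j , ij , bi , bj) with isMedian? u
  ... | yes mu = u , mu
  ... | no nm with ¬median⇒joinedPair nm
  ... | k , l , kl , ku , lu , wkl with branchOf {u} {ρ k} tt tt ku
  ... | u' , euu' , wu'k with u' ≟ v
  ... | yes refl with pairsMeet i j k l ij kl
  ... | t , inj₁ refl , inj₁ refl = ⊥-elim (facingBranches-disjoint evu bi (ku , reversePath delete-symm wu'k))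
  ... | t , inj₁ refl , inj₂ refl = ⊥-elim (facingBranches-disjoint evu bi (lu , reversePath delete-symm wkl ++ₚ reversePath delete-symm wu'k))
  ... | t , inj₂ refl , inj₁ refl = ⊥-elim (facingBranches-disjoint evu bj (ku , reversePath delete-symm wu'k))
  ... | t , inj₂ refl , inj₂ refl = ⊥-elim (facingBranches-disjoint evu bj (lu , reversePath delete-symm wkl ++ₚ reversePath delete-symm wu'k))
  descend (suc m) v u lt (evu , i , j , ij , bi , bj)
      | no nm | k , l , kl , ku , lu , wkl | u' , euu' , wu'k | no u'v =
    descend m u u' lt' (euu' , k , l , kl , (ku , reversePath delete-symm wu'k) , (lu , reversePath delete-symm wkl ++ₚ reversePath delete-symm wu'k))
    where
      uv : u ≢ v
      uv eq = edge⇒≢ evu (sym eq)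
      lt' : countTrue (inBranchᵇ u u') < m
      lt' = ℕP.<-≤-trans
              (countTrue-< (inBranchᵇ u u') (inBranchᵇ v u)
                 (λ x bx → ⇒isYes (inBranch? v u x) (subBranch evu euu' u'v (isYes⇒ (inBranch? u u' x) bx)))
                 u (⇒isYes (inBranch? v u u) (uv , stop)) (λ bu → proj₁ (isYes⇒ (inBranch? u u' u) bu) refl))
              (ℕP.≤-pred lt)

  -- Start at ρ 0: either it is a median or two roots lie in one of its branches.
  median-exists : ∃ IsMedian
  median-exists with isMedian? (ρ zero)
  ... | yes m = _ , m
  ... | no nm with ¬median⇒joinedPair nm
  ... | i , j , ij , a , b , w with branchOf {ρ zero} {ρ i} tt tt a
  ... | u , e , wu = descend (suc n) (ρ zero) u (s≤s (countTrue≤ _))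
                       (e , i , j , ij , (a , reversePath delete-symm wu) , (b , reversePath delete-symm w ++ₚ reversePath delete-symm wu))

  twoRootsInBranch : ∀ {v u i j} → IsMedian v → i ≢ j → InBranch v u (ρ i) → InBranch v u (ρ j) → ⊥
  twoRootsInBranch {i = i} {j} m ij bi bj with m i j ij
  ... | inj₁ e = proj₁ bi e
  ... | inj₂ (inj₁ e) = proj₁ bj e
  ... | inj₂ (inj₂ nw) = nw (proj₂ bi ++ₚ reversePath delete-symm (proj₂ bj))

  -- Two distinct medians v, w: every root lies in the branch of v towards w or
  -- in the branch of w towards v, so one of them contains two roots.
  median-unique : ∀ {v w} → IsMedian v → IsMedian w → v ≡ w
  median-unique {v} {w} mv mw with v ≟ w
  ... | yes eq = eq
  ... | no vw with branchOf {v} {w} tt tt (λ e → vw (sym e)) | branchOf {w} {v} tt tt vw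
  ... | u , evu , wuw | u' , ewu' , wu'v with pigeonhole3 C
    where
      C : ∀ t → InBranch v u (ρ t) ⊎ InBranch w u' (ρ t)
      C t with inBranch? v u (ρ t)
      ... | yes b = inj₁ b
      ... | no nb with ρ t ≟ v
      ... | yes refl = inj₂ (vw , reversePath delete-symm wu'v)
      ... | no xv with branchOf {v} {ρ t} tt tt xv
      ... | u'' , evu'' , wx with u'' ≟ u
      ... | yes refl = ⊥-elim (nb (xv , reversePath delete-symm wx))
      ... | no u''u = inj₂ (q W , (W' ++ₚ step (delete-intro {g = g} {v = w} (symm evu'') (q stop) vw) (reversePath delete-symm wu'v)))
        where
          q : ∀ {y} → Path (delete g v) y u'' → y ≢ w
          q wy refl = noBypass evu evu'' (λ e → u''u (sym e)) (wuw ++ₚ wy)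
          W : Path (delete g v) (ρ t) u''
          W = reversePath delete-symm wx
          W' : Path (delete g w) (ρ t) u''
          W' = transferPath (λ e qy qz → delete-intro {g = g} {v = w} (delete-⊆ {g = g} {v = v} e) qy qz) q W
  ... | inj₁ (i , j , ij , bi , bj) = ⊥-elim (twoRootsInBranch mv ij bi bj)
  ... | inj₂ (i , j , ij , bi , bj) = ⊥-elim (twoRootsInBranch mw ij bi bj)

module _ {n : ℕ} where

  TreeOn-cong : ∀ {S S' : Fin n → Set} {g g' : Graph n} → TreeOn S g →
            (∀ {x} → S x → S' x) → (∀ {x} → S' x → S x) → (∀ i j → g i j ≡ g' i j) → TreeOn S' g'
  TreeOn-cong {S} {S'} {g} {g'} T f b eq = record
    { symm = λ e → fw (TreeOn.symm T (bw e))
    ; irrefl = λ e → TreeOn.irrefl T (bw e)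
    ; edgeInS = λ e → f (TreeOn.edgeInS T (bw e))
    ; connect = λ si sj → weakenPath fw (TreeOn.connect T (b si) (b sj))
    ; noBypass = λ eu ew uw W → TreeOn.noBypass T (bw eu) (bw ew) uw (weakenPath dbw W)
    }
    where
      fw : ∀ {i j} → Edge g i j → Edge g' i j
      fw {i} {j} ⟨ e ⟩ = ⟨ trans (sym (eq i j)) e ⟩
      bw : ∀ {i j} → Edge g' i j → Edge g i j
      bw {i} {j} ⟨ e ⟩ = ⟨ trans (eq i j) e ⟩
      dbw : ∀ {v i j} → Edge (delete g' v) i j → Edge (delete g v) i j
      dbw {v} e with delete-elim {g = g'} {v = v} e
      ... | e1 , a , c = delete-intro {g = g} {v = v} (bw e1) a c

-- JoinHalf proves
-- the no-bypass property at vertices of the first tree, by projecting a path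
-- of the joined graph onto the first tree (collapsing the second one onto s1).
module JoinHalf {n : ℕ} (g1 g2 h : Graph n) (S1 S2 : Fin n → Set) (S1? : ∀ x → Dec (S1 x))
    (s1 s2 : Fin n) (T1 : TreeOn S1 g1) (T2 : TreeOn S2 g2) (disj : ∀ {x} → S1 x → S2 x → ⊥)
    (s1∈ : S1 s1) (s2∈ : S2 s2)
    (edgeCases : ∀ {i j} → Edge h i j → Edge g1 i j ⊎ Edge g2 i j ⊎ (i ≡ s1 × j ≡ s2) ⊎ (i ≡ s2 × j ≡ s1)) where

  collapse : Fin n → Fin n
  collapse x with S1? x
  ... | yes _ = x
  ... | no _ = s1

  collapse-S1 : ∀ {x} → S1 x → collapse x ≡ x
  collapse-S1 {x} sx with S1? x
  ... | yes _ = refl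
  ... | no ns = ⊥-elim (ns sx)

  collapse-S2 : ∀ {x} → ¬ S1 x → collapse x ≡ s1
  collapse-S2 {x} nx with S1? x
  ... | yes sx = ⊥-elim (nx sx)
  ... | no _ = refl

  S2⇒¬S1 : ∀ {x} → S2 x → ¬ S1 x
  S2⇒¬S1 s2x s1x = disj s1x s2x

  -- Away from the joint, the projection of a bypass in h is a bypass in T1.
  noBypassAway : ∀ {v u w} → S1 v → v ≢ s1 → Edge h v u → Edge h v w → u ≢ w → ¬ Path (delete h v) u w
  noBypassAway {v} {u} {w} sv vs1 eu ew uw W = TreeOn.noBypass T1 eu1 ew1 uw W2
    where
      g1e : ∀ {z} → Edge h v z → Edge g1 v z
      g1e e with edgeCases e
      ... | inj₁ e1 = e1
      ... | inj₂ (inj₁ e2) = ⊥-elim (disj sv (TreeOn.edgeInS T2 e2))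
      ... | inj₂ (inj₂ (inj₁ (a , _))) = ⊥-elim (vs1 a)
      ... | inj₂ (inj₂ (inj₂ (refl , _))) = ⊥-elim (disj sv s2∈)
      eu1 : Edge g1 v u
      eu1 = g1e eu
      ew1 : Edge g1 v w
      ew1 = g1e ew
      hf : ∀ {y z} → Edge (delete h v) y z → collapse y ≡ collapse z ⊎ Edge (delete g1 v) (collapse y) (collapse z)
      hf {y} {z} e with delete-elim {g = h} {v = v} e
      ... | e' , yv , zv with edgeCases e'
      ... | inj₁ e1 rewrite collapse-S1 (TreeOn.edgeInS T1 e1) | collapse-S1 (TreeOn.edgeInS T1 (TreeOn.symm T1 e1)) =
              inj₂ (delete-intro {g = g1} {v = v} e1 yv zv)
      ... | inj₂ (inj₁ e2) rewrite collapse-S2 (S2⇒¬S1 (TreeOn.edgeInS T2 e2)) | collapse-S2 (S2⇒¬S1 (TreeOn.edgeInS T2 (TreeOn.symm T2 e2))) = inj₁ refl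
      ... | inj₂ (inj₂ (inj₁ (refl , refl))) rewrite collapse-S1 s1∈ | collapse-S2 (S2⇒¬S1 s2∈) = inj₁ refl
      ... | inj₂ (inj₂ (inj₂ (refl , refl))) rewrite collapse-S1 s1∈ | collapse-S2 (S2⇒¬S1 s2∈) = inj₁ refl
      W1 : Path (delete g1 v) (collapse u) (collapse w)
      W1 = mapPath collapse hf W
      W2 : Path (delete g1 v) u w
      W2 = subst₂ (Path (delete g1 v)) (collapse-S1 (TreeOn.edgeInS T1 (TreeOn.symm T1 eu1))) (collapse-S1 (TreeOn.edgeInS T1 (TreeOn.symm T1 ew1))) W1
  -- At the joint s1, a bypass either stays in the first tree or would have to
  -- cross into the second one, which is only reachable through s1.
  noBypassAtJoint : ∀ {u w} → Edge h s1 u → Edge h s1 w → u ≢ w → ¬ Path (delete h s1) u w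
  noBypassAtJoint {u} {w} eu ew uw W = go (cls eu) (cls ew)
    where
      cls : ∀ {z} → Edge h s1 z → Edge g1 s1 z ⊎ z ≡ s2
      cls e with edgeCases e
      ... | inj₁ e1 = inj₁ e1
      ... | inj₂ (inj₁ e2) = ⊥-elim (disj s1∈ (TreeOn.edgeInS T2 e2))
      ... | inj₂ (inj₂ (inj₁ (_ , b))) = inj₂ b
      ... | inj₂ (inj₂ (inj₂ (a , _))) = ⊥-elim (disj s1∈ (subst S2 (sym a) s2∈))
      stay1 : ∀ {y z} → Edge (delete h s1) y z → S1 y → S1 z × Edge (delete g1 s1) y z
      stay1 {y} {z} e sy with delete-elim {g = h} {v = s1} e
      ... | e' , yv , zv with edgeCases e'
      ... | inj₁ e1 = TreeOn.edgeInS T1 (TreeOn.symm T1 e1) , delete-intro {g = g1} {v = s1} e1 yv zv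
      ... | inj₂ (inj₁ e2) = ⊥-elim (disj sy (TreeOn.edgeInS T2 e2))
      ... | inj₂ (inj₂ (inj₁ (a , _))) = ⊥-elim (yv a)
      ... | inj₂ (inj₂ (inj₂ (refl , _))) = ⊥-elim (disj sy s2∈)
      stay2 : ∀ {y z} → Edge (delete h s1) y z → S2 y → S2 z × Edge (delete h s1) y z
      stay2 {y} {z} e sy with delete-elim {g = h} {v = s1} e
      ... | e' , yv , zv with edgeCases e'
      ... | inj₁ e1 = ⊥-elim (disj (TreeOn.edgeInS T1 e1) sy)
      ... | inj₂ (inj₁ e2) = TreeOn.edgeInS T2 (TreeOn.symm T2 e2) , e
      ... | inj₂ (inj₂ (inj₁ (a , _))) = ⊥-elim (yv a)
      ... | inj₂ (inj₂ (inj₂ (_ , b))) = ⊥-elim (zv b)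
      go : Edge g1 s1 u ⊎ u ≡ s2 → Edge g1 s1 w ⊎ w ≡ s2 → ⊥
      go (inj₁ a) (inj₁ b) = TreeOn.noBypass T1 a b uw (proj₁ (carryPath S1 stay1 (TreeOn.edgeInS T1 (TreeOn.symm T1 a)) W))
      go (inj₁ a) (inj₂ refl) = disj (proj₂ (carryPath S1 stay1 (TreeOn.edgeInS T1 (TreeOn.symm T1 a)) W)) s2∈
      go (inj₂ refl) (inj₁ b) = disj (TreeOn.edgeInS T1 (TreeOn.symm T1 b)) (proj₂ (carryPath S2 stay2 s2∈ W))
      go (inj₂ refl) (inj₂ refl) = uw refl

  noBypassFrom₁ : ∀ {v u w} → S1 v → Edge h v u → Edge h v w → u ≢ w → ¬ Path (delete h v) u w
  noBypassFrom₁ {v} sv with v ≟ s1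
  ... | no vs1 = noBypassAway sv vs1
  ... | yes refl = noBypassAtJoint

module Join {n : ℕ} (g1 g2 h : Graph n) (S1 S2 : Fin n → Set)
    (S1? : ∀ x → Dec (S1 x)) (S2? : ∀ x → Dec (S2 x))
    (s1 s2 : Fin n) (T1 : TreeOn S1 g1) (T2 : TreeOn S2 g2) (disj : ∀ {x} → S1 x → S2 x → ⊥)
    (s1∈ : S1 s1) (s2∈ : S2 s2)
    (edgeCases : ∀ {i j} → Edge h i j → Edge g1 i j ⊎ Edge g2 i j ⊎ (i ≡ s1 × j ≡ s2) ⊎ (i ≡ s2 × j ≡ s1))
    (incl₁ : ∀ {i j} → Edge g1 i j → Edge h i j) (incl₂ : ∀ {i j} → Edge g2 i j → Edge h i j)
    (bridge₁₂ : Edge h s1 s2) (bridge₂₁ : Edge h s2 s1) where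

  edgeCases′ : ∀ {i j} → Edge h i j → Edge g2 i j ⊎ Edge g1 i j ⊎ (i ≡ s2 × j ≡ s1) ⊎ (i ≡ s1 × j ≡ s2)
  edgeCases′ e with edgeCases e
  ... | inj₁ a = inj₂ (inj₁ a)
  ... | inj₂ (inj₁ a) = inj₁ a
  ... | inj₂ (inj₂ (inj₁ a)) = inj₂ (inj₂ (inj₂ a))
  ... | inj₂ (inj₂ (inj₂ a)) = inj₂ (inj₂ (inj₁ a))

  module H1 = JoinHalf g1 g2 h S1 S2 S1? s1 s2 T1 T2 disj s1∈ s2∈ edgeCases
  module H2 = JoinHalf g2 g1 h S2 S1 S2? s2 s1 T2 T1 (λ a b → disj b a) s2∈ s1∈ edgeCases′

  S : Fin n → Set
  S x = S1 x ⊎ S2 x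

  joined-symm : Symmetric h
  joined-symm e with edgeCases e
  ... | inj₁ a = incl₁ (TreeOn.symm T1 a)
  ... | inj₂ (inj₁ a) = incl₂ (TreeOn.symm T2 a)
  ... | inj₂ (inj₂ (inj₁ (refl , refl))) = bridge₂₁
  ... | inj₂ (inj₂ (inj₂ (refl , refl))) = bridge₁₂

  joined-edgeInS : ∀ {i j} → Edge h i j → S i
  joined-edgeInS e with edgeCases e
  ... | inj₁ a = inj₁ (TreeOn.edgeInS T1 a)
  ... | inj₂ (inj₁ a) = inj₂ (TreeOn.edgeInS T2 a)
  ... | inj₂ (inj₂ (inj₁ (refl , _))) = inj₁ s1∈
  ... | inj₂ (inj₂ (inj₂ (refl , _))) = inj₂ s2∈

  pathTo-s1 : ∀ {x} → S x → Path h x s1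
  pathTo-s1 (inj₁ sx) = weakenPath incl₁ (TreeOn.connect T1 sx s1∈)
  pathTo-s1 (inj₂ sx) = weakenPath incl₂ (TreeOn.connect T2 sx s2∈) ++ₚ edgePath bridge₂₁

  joined : TreeOn S h
  joined = record
    { symm = joined-symm
    ; irrefl = joined-irrefl
    ; edgeInS = joined-edgeInS
    ; connect = λ si sj → pathTo-s1 si ++ₚ reversePath joined-symm (pathTo-s1 sj)
    ; noBypass = λ eu ew uw W → joined-noBypass (joined-edgeInS eu) eu ew uw W
    }
    where
      joined-irrefl : ∀ {i} → ¬ Edge h i i
      joined-irrefl e with edgeCases e
      ... | inj₁ a = TreeOn.irrefl T1 a
      ... | inj₂ (inj₁ a) = TreeOn.irrefl T2 a
      ... | inj₂ (inj₂ (inj₁ (refl , b))) = disj s1∈ (subst S2 (sym b) s2∈)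
      ... | inj₂ (inj₂ (inj₂ (refl , b))) = disj (subst S1 (sym b) s1∈) s2∈
      joined-noBypass : ∀ {v u w} → S v → Edge h v u → Edge h v w → u ≢ w → ¬ Path (delete h v) u w
      joined-noBypass (inj₁ sv) = H1.noBypassFrom₁ sv
      joined-noBypass (inj₂ sv) = H2.noBypassFrom₁ sv

module _ {n : ℕ} where

  adj : Adj n → Graph n
  adj A i j = lookup (lookup A i) j

  toAdj : Graph n → Adj n
  toAdj f = tabulate (λ i → tabulate (λ j → f i j))

  adj-toAdj : ∀ (f : Graph n) i j → adj (toAdj f) i j ≡ f i j
  adj-toAdj f i j = trans (cong (λ r → lookup r j) (VP.lookup∘tabulate _ i)) (VP.lookup∘tabulate _ j)

  toSubset : (Fin n → Bool) → Subset n
  toSubset f = tabulate f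

  inSet : Subset n → Fin n → Set
  inSet p x = lookup p x ≡ true

  ∈⇒inSet : ∀ {p x} → x ∈ p → inSet p x
  ∈⇒inSet = VP.[]=⇒lookup

  inSet⇒∈ : ∀ {p x} → inSet p x → x ∈ p
  inSet⇒∈ {p} {x} = VP.lookup⇒[]= x p

  lookup-toSubset : ∀ (f : Fin n → Bool) x → lookup (toSubset f) x ≡ f x
  lookup-toSubset f x = VP.lookup∘tabulate f x

  walk⇒path : ∀ {A : Adj n} {i j} → Walk A i j → Path (adj A) i j
  walk⇒path stop = stop
  walk⇒path (step e w) = step ⟨ e ⟩ (walk⇒path w)

  path⇒walk : ∀ {A : Adj n} {i j} → Path (adj A) i j → Walk A i j
  path⇒walk stop = stop
  path⇒walk (step ⟨ e ⟩ w) = step e (path⇒walk w)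

vec-ext : ∀ {a} {A : Set a} {m} (xs ys : Vec A m) → (∀ i → lookup xs i ≡ lookup ys i) → xs ≡ ys
vec-ext xs ys h = begin
  xs                  ≡⟨ VP.tabulate∘lookup xs ⟨
  tabulate (lookup xs) ≡⟨ VP.tabulate-cong h ⟩
  tabulate (lookup ys) ≡⟨ VP.tabulate∘lookup ys ⟩
  ys                  ∎
  where open ≡-Reasoning

module _ {n : ℕ} where

  lookup-∩ : ∀ (p q : Subset n) x → lookup (p ∩ q) x ≡ lookup p x ∧ lookup q x
  lookup-∩ p q x = VP.lookup-zipWith _∧_ x p q

  lookup-∪ : ∀ (p q : Subset n) x → lookup (p ∪ q) x ≡ lookup p x ∨ lookup q x
  lookup-∪ p q x = VP.lookup-zipWith _∨_ x p q

  lookup-∅ : ∀ (x : Fin n) → lookup (EmptySet {n}) x ≡ false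
  lookup-∅ x = VP.lookup-replicate x false

  lookup-full : ∀ (x : Fin n) → lookup (FullSet {n}) x ≡ true
  lookup-full x = VP.lookup-replicate x true

  subset≟ : (S S' : Subset n) → Dec (S ≡ S')
  subset≟ = VP.≡-dec B._≟_

  -- Reading the (irrelevant) set equations of a composition pointwise;
  -- equality of subsets is decidable, so the proofs can be recomputed.
  disjoint⇒ : ∀ {p q : Subset n} → .(p ∩ q ≡ EmptySet) → ∀ {x} → inSet p x → inSet q x → ⊥
  disjoint⇒ {p} {q} eq {x} a b = false≢true (trans (sym (lookup-∅ x))
    (trans (cong (λ r → lookup r x) (sym (recompute (subset≟ _ _) eq))) (trans (lookup-∩ p q x) (∧-intro a b))))

  cover⇒ : ∀ {p q r : Subset n} → .(p ∪ (q ∪ r) ≡ FullSet) → ∀ x → inSet p x ⊎ inSet q x ⊎ inSet r x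
  cover⇒ {p} {q} {r} eq x with ∨-elim {lookup p x} (trans (sym (lookup-∪ p (q ∪ r) x))
    (trans (cong (λ s → lookup s x) (recompute (subset≟ _ _) eq)) (lookup-full x)))
  ... | inj₁ a = inj₁ a
  ... | inj₂ b with ∨-elim {lookup q x} (trans (sym (lookup-∪ q r x)) b)
  ... | inj₁ c = inj₂ (inj₁ c)
  ... | inj₂ c = inj₂ (inj₂ c)

  empty⇒ : ∀ {p : Subset n} → .(p ≡ EmptySet) → ∀ {x} → ¬ inSet p x
  empty⇒ {p} eq {x} h = false≢true (trans (sym (lookup-∅ x))
    (trans (cong (λ r → lookup r x) (sym (recompute (subset≟ _ _) eq))) h))

module _ {n : ℕ} where

  toSubset-ext : ∀ (f : Fin n → Bool) (S : Subset n) → (∀ x → f x ≡ lookup S x) → toSubset f ≡ S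
  toSubset-ext f S h = vec-ext _ _ (λ x → trans (lookup-toSubset f x) (h x))

  toSubset-disjoint : ∀ (f h : Fin n → Bool) → (∀ x → f x ∧ h x ≡ false) → toSubset f ∩ toSubset h ≡ EmptySet
  toSubset-disjoint f h d = vec-ext _ _ λ x → begin
    lookup (toSubset f ∩ toSubset h) x          ≡⟨ lookup-∩ (toSubset f) (toSubset h) x ⟩
    lookup (toSubset f) x ∧ lookup (toSubset h) x ≡⟨ cong₂ _∧_ (lookup-toSubset f x) (lookup-toSubset h x) ⟩
    f x ∧ h x                                   ≡⟨ d x ⟩
    false                                       ≡⟨ lookup-∅ x ⟨
    lookup EmptySet x                           ∎
    where open ≡-Reasoning

  toSubset-cover : ∀ (f h k : Fin n → Bool) → (∀ x → f x ∨ (h x ∨ k x) ≡ true) →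
                   toSubset f ∪ (toSubset h ∪ toSubset k) ≡ FullSet
  toSubset-cover f h k c = vec-ext _ _ λ x → begin
    lookup (toSubset f ∪ (toSubset h ∪ toSubset k)) x
      ≡⟨ lookup-∪ (toSubset f) _ x ⟩
    lookup (toSubset f) x ∨ lookup (toSubset h ∪ toSubset k) x
      ≡⟨ cong₂ _∨_ (lookup-toSubset f x) (trans (lookup-∪ (toSubset h) (toSubset k) x)
                                                (cong₂ _∨_ (lookup-toSubset h x) (lookup-toSubset k x))) ⟩
    f x ∨ (h x ∨ k x)
      ≡⟨ c x ⟩
    true
      ≡⟨ lookup-full x ⟨
    lookup FullSet x ∎
    where open ≡-Reasoning

-- Acyclicity (the notion used by Defs) is equivalent to the no-bypass
-- property: a cycle x ⋯ v ⋯ x through v gives a bypass between the two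
-- neighbours of v on the cycle, and a simple bypass closes up into a cycle.
module Cycles {n : ℕ} (A : Adj n) where
  g : Graph n
  g = adj A

  lastOf : Fin n → List (Fin n) → Fin n
  lastOf y [] = y
  lastOf y (z ∷ zs) = lastOf z zs

  lastOf∈ : ∀ y zs → lastOf y zs ∈ₗ (y ∷ zs)
  lastOf∈ y [] = here refl
  lastOf∈ y (z ∷ zs) = there (lastOf∈ z zs)

  chain⇒path : ∀ (x y : Fin n) zs → All (x ≢_) (y ∷ zs) → Chain A (y ∷ (zs ++ x ∷ [])) →
           Path (delete g x) y (lastOf y zs) × Edge g (lastOf y zs) x
  chain⇒path x y [] (a ∷ _) (e , _) = stop , ⟨ e ⟩
  chain⇒path x y (z ∷ zs) (a ∷ b ∷ as) (e , c) with chain⇒path x z zs (b ∷ as) c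
  ... | w , e' = step (delete-intro {g = g} {v = x} ⟨ e ⟩ (λ q → a (sym q)) (λ q → b (sym q))) w , e'

  noBypass⇒acyclic : (∀ {v u w} → Edge g v u → Edge g v w → u ≢ w → ¬ Path (delete g v) u w) → Symmetric g → ¬ HasCycle A
  noBypass⇒acyclic noBypass sy (x , u ∷ [] , (s≤s ()) , _ , _)
  noBypass⇒acyclic noBypass sy (x , u ∷ y ∷ ys , _ , (xu ∷ (uys ∷ _)) , (e , c)) with chain⇒path x u (y ∷ ys) xu c
  ... | w , e' = noBypass ⟨ e ⟩ (sy e') ne w
    where
      ne : u ≢ lastOf y ys
      ne eq = All.lookup uys (lastOf∈ y ys) eq

  avoids : ∀ {v a b} (w : Path (delete g v) a b) → a ≢ v → All (v ≢_) (vertices w)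
  avoids stop av = (λ q → av (sym q)) ∷ []
  avoids {v} (step e w) av = (λ q → av (sym q)) ∷ avoids w (proj₂ (proj₂ (delete-elim {g = g} {v = v} e)))

  path⇒chain : ∀ {v a b} (w : Path (delete g v) a b) → Edge g b v → Chain A (vertices w ++ v ∷ [])
  path⇒chain stop ⟨ e ⟩ = e , _
  path⇒chain {v} (step e stop) eb = holds (delete-⊆ {g = g} {v = v} e) , path⇒chain stop eb
  path⇒chain {v} (step e (step e' w)) eb = holds (delete-⊆ {g = g} {v = v} e) , path⇒chain (step e' w) eb

  acyclic⇒noBypass : Symmetric g → (∀ {i} → ¬ Edge g i i) → ¬ HasCycle A →
            ∀ {v u w} → Edge g v u → Edge g v w → u ≢ w → ¬ Path (delete g v) u w
  acyclic⇒noBypass sy ir ac {v} {u} {w} eu ew uw W with simplify W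
  ... | stop , _ = uw refl
  ... | step e W' , un' =
      ac (v , vertices (step e W') , s≤s (subst (1 ≤_) (sym (length-vertices W')) (s≤s z≤n)) ,
          (avoids (step e W') uv ∷ un') , (holds eu , path⇒chain (step e W') (sy ew)))
    where
      uv : u ≢ v
      uv refl = ir eu

module _ {n : ℕ} where

  isTree⇒TreeOn : ∀ {S : Subset n} {A : Adj n} → IsTree S A → TreeOn (inSet S) (adj A)
  isTree⇒TreeOn {S} {A} t = record
    { symm = λ {i} {j} e → ⟨ IsTree.symmetric t i j (holds e) ⟩
    ; irrefl = λ {i} e → IsTree.loopless t i (holds e)
    ; edgeInS = λ {i} {j} e → ∈⇒inSet (proj₁ (IsTree.edgesInS t i j (holds e)))
    ; connect = λ {i} {j} si sj → walk⇒path (IsTree.connected t i j (inSet⇒∈ si) (inSet⇒∈ sj))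
    ; noBypass = Cycles.acyclic⇒noBypass A (λ {i} {j} e → ⟨ IsTree.symmetric t i j (holds e) ⟩) (λ {i} e → IsTree.loopless t i (holds e)) (IsTree.acyclic t)
    }

  TreeOn⇒isTree : ∀ {S : Subset n} {A : Adj n} → TreeOn (inSet S) (adj A) → Nonempty S → IsTree S A
  TreeOn⇒isTree {S} {A} T ne = record
    { symmetric = λ i j e → holds (TreeOn.symm T ⟨ e ⟩)
    ; loopless = λ i e → TreeOn.irrefl T ⟨ e ⟩
    ; edgesInS = λ i j e → inSet⇒∈ (TreeOn.edgeInS T ⟨ e ⟩) , inSet⇒∈ (TreeOn.edgeInS T (TreeOn.symm T ⟨ e ⟩))
    ; nonempty = ne
    ; connected = λ i j si sj → path⇒walk (TreeOn.connect T (∈⇒inSet si) (∈⇒inSet sj))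
    ; acyclic = Cycles.noBypass⇒acyclic A (TreeOn.noBypass T) (TreeOn.symm T)
    }

  -- IsTree is recomputable: all its fields are decidable or negations, so the
  -- irrelevant proofs stored in DRTree and TRTree can be used in proofs.
  isTree-recompute : ∀ {S : Subset n} {A : Adj n} → .(IsTree S A) → IsTree S A
  isTree-recompute {S} {A} t = record
    { symmetric = λ i j e → recompute (adj A j i B.≟ true) (IsTree.symmetric t i j e)
    ; loopless = λ i e → ⊥-elim-irr (IsTree.loopless t i e)
    ; edgesInS = λ i j e → recompute ((i SSP.∈? S) ×-dec (j SSP.∈? S)) (IsTree.edgesInS t i j e)
    ; nonempty = recompute (SSP.nonempty? S) (IsTree.nonempty t)
    ; connected = λ i j i∈ j∈ → path⇒walk (recompute (path? (adj A) i j) (walk⇒path (IsTree.connected t i j i∈ j∈)))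
    ; acyclic = λ c → ⊥-elim-irr (IsTree.acyclic t c)
    }

core∧branch₁ : ∀ a b → (not a ∧ not b) ∧ a ≡ false
core∧branch₁ true b = refl
core∧branch₁ false true = refl
core∧branch₁ false false = refl

core∧branch₂ : ∀ a b → (not a ∧ not b) ∧ b ≡ false
core∧branch₂ true b = refl
core∧branch₂ false true = refl
core∧branch₂ false false = refl

core∨branches : ∀ a b → (not a ∧ not b) ∨ (a ∨ b) ≡ true
core∨branches true b = refl
core∨branches false true = refl
core∨branches false false = refl

⇒isNo-false : ∀ {a} {A : Set a} (d : Dec A) → ¬ A → ⌊ d ⌋ ≡ false
⇒isNo-false (yes a) na = ⊥-elim (na a)
⇒isNo-false (no _) _ = refl

module _ {n : ℕ} where
  edge? : (g : Graph n) → ∀ i j → Dec (Edge g i j)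
  edge? g i j = map′ ⟨_⟩ holds (g i j B.≟ true)

  restrict : Graph n → (Fin n → Bool) → Graph n
  restrict g s i j = g i j ∧ (s i ∧ s j)

  -- The cut of a tree at v: branchSet g v r is the branch of v containing r
  -- (empty if r = v); coreSet g v r1 r2 is everything outside the branches of
  -- r1 and r2, in particular v itself.
  branchSet : Graph n → Fin n → Fin n → Fin n → Bool
  branchSet g v r x = not ⌊ x ≟ v ⌋ ∧ ⌊ path? (delete g v) x r ⌋

  coreSet : Graph n → Fin n → Fin n → Fin n → Fin n → Bool
  coreSet g v r1 r2 x = not (branchSet g v r1 x) ∧ not (branchSet g v r2 x)

  ¬pathToDeleted : ∀ {g : Graph n} {v x} → x ≢ v → ¬ Path (delete g v) x v
  ¬pathToDeleted xv stop = xv refl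
  ¬pathToDeleted {g} {v} xv (step e w) = ¬pathToDeleted (proj₂ (proj₂ (delete-elim {g = g} {v = v} e))) w

  branchSet-intro : ∀ {g : Graph n} {v r x} → x ≢ v → Path (delete g v) x r → branchSet g v r x ≡ true
  branchSet-intro {g} {v} {r} {x} xv w = ∧-intro (⇒isNo (x ≟ v) xv) (⇒isYes (path? (delete g v) x r) w)

  branchSet-elim : ∀ {g : Graph n} {v r x} → branchSet g v r x ≡ true → x ≢ v × Path (delete g v) x r
  branchSet-elim {g} {v} {r} {x} e with ∧-elim {not ⌊ x ≟ v ⌋} e
  ... | a , b = isNo⇒ (x ≟ v) a , isYes⇒ (path? (delete g v) x r) b

  branchSet-centre : ∀ {g : Graph n} {v r} → branchSet g v r v ≡ false
  branchSet-centre {g} {v} {r} with v ≟ v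
  ... | yes _ = refl
  ... | no nv = ⊥-elim (nv refl)

  branchSet-of-centre : ∀ {g : Graph n} {v} x → branchSet g v v x ≡ false
  branchSet-of-centre {g} {v} x with x ≟ v
  ... | yes _ = refl
  ... | no xv = ⇒isNo-false (path? (delete g v) x v) (¬pathToDeleted xv)

  coreSet-centre : ∀ {g : Graph n} {v r1 r2} → coreSet g v r1 r2 v ≡ true
  coreSet-centre {g} {v} {r1} {r2} rewrite branchSet-centre {g} {v} {r1} | branchSet-centre {g} {v} {r2} = refl

  branchSet-forward : ∀ {g : Graph n} {v r y z} → Symmetric g → Edge (delete g v) y z → branchSet g v r y ≡ true → branchSet g v r z ≡ true
  branchSet-forward {g} {v} sy e hy with branchSet-elim {g} hy | delete-elim {g = g} {v = v} e
  ... | yv , w | _ , _ , zv = branchSet-intro zv (step (delete-symmetric sy e) w)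

  branchSet-backward : ∀ {g : Graph n} {v r y z} → Edge (delete g v) y z → branchSet g v r z ≡ true → branchSet g v r y ≡ true
  branchSet-backward {g} {v} e hz with branchSet-elim {g} hz | delete-elim {g = g} {v = v} e
  ... | zv , w | _ , yv , _ = branchSet-intro yv (step e w)

  restrict-elim : ∀ {g : Graph n} {s i j} → Edge (restrict g s) i j → Edge g i j × s i ≡ true × s j ≡ true
  restrict-elim {g} {s} {i} {j} ⟨ e ⟩ with ∧-elim {g i j} e
  ... | a , b with ∧-elim {s i} b
  ... | c , d = ⟨ a ⟩ , c , d

  restrict-intro : ∀ {g : Graph n} {s i j} → Edge g i j → s i ≡ true → s j ≡ true → Edge (restrict g s) i j
  restrict-intro ⟨ e ⟩ a b = ⟨ ∧-intro e (∧-intro a b) ⟩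

  restrict-symm : ∀ {g : Graph n} {s} → Symmetric g → Symmetric (restrict g s)
  restrict-symm {g} {s} sy e = let (a , b , c) = restrict-elim {g = g} {s = s} e in restrict-intro {g = g} {s = s} (sy a) c b

  restrict-TreeOn : ∀ {S} {g : Graph n} → TreeOn S g → (s : Fin n → Bool) →
          (∀ {x y} → s x ≡ true → s y ≡ true → Path (restrict g s) x y) → TreeOn (λ x → s x ≡ true) (restrict g s)
  restrict-TreeOn {g = g} T s cn = record
    { symm = λ e → let (a , b , c) = restrict-elim {g = g} {s = s} e in restrict-intro {g = g} {s = s} (TreeOn.symm T a) c b
    ; irrefl = λ e → TreeOn.irrefl T (proj₁ (restrict-elim {g = g} {s = s} e))
    ; edgeInS = λ e → proj₁ (proj₂ (restrict-elim {g = g} {s = s} e))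
    ; connect = cn
    ; noBypass = λ {v} eu ew uw W → TreeOn.noBypass T (proj₁ (restrict-elim {g = g} {s = s} eu)) (proj₁ (restrict-elim {g = g} {s = s} ew)) uw
                  (weakenPath (λ e → let (a , b , c) = delete-elim {g = restrict g s} {v = v} e
                                in delete-intro {g = g} {v = v} (proj₁ (restrict-elim {g = g} {s = s} a)) b c) W)
    }

  fullTreeOn : ∀ {A : Adj n} → .(IsTree FullSet A) → TreeOn (λ _ → ⊤) (adj A)
  fullTreeOn it = TreeOn-cong (isTree⇒TreeOn (isTree-recompute it)) (λ _ → tt) (λ {x} _ → lookup-full x) (λ _ _ → refl)

  TreeOn-toSubset : ∀ {s : Fin n → Bool} {g : Graph n} → TreeOn (λ x → s x ≡ true) g → TreeOn (inSet (toSubset s)) (adj (toAdj g))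
  TreeOn-toSubset {s} {g} T = TreeOn-cong T (λ {x} h → trans (lookup-toSubset s x) h) (λ {x} h → trans (sym (lookup-toSubset s x)) h)
                      (λ i j → sym (adj-toAdj g i j))

  -- The median, found by exhaustive search; the search succeeds by median-exists.
  findMedian : (g : Graph n) (ρ : Fin 3 → Fin n) .(T : TreeOn (λ _ → ⊤) g) → Σ (Fin n) (MedianDef.IsMedian g ρ)
  findMedian g ρ T with FP.any? (MedianDef.isMedian? g ρ)
  ... | yes r = r
  ... | no nr = ⊥-elim-irr (nr (MedianFacts.median-exists T ρ))

  findNeighbour : (g : Graph n) .(T : TreeOn (λ _ → ⊤) g) (v x : Fin n) → .(x ≢ v) →
            Σ (Fin n) (λ u → Edge g v u × Path (delete g v) u x)
  findNeighbour g T v x ne with FP.any? (λ u → edge? g v u ×-dec path? (delete g v) u x)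
  ... | yes r = r
  ... | no nr = ⊥-elim-irr (nr (TreeFacts.branchOf T tt tt ne))

module CutFacts {n : ℕ} {g : Graph n} (T : TreeOn (λ _ → ⊤) g) (ρ : Fin 3 → Fin n) (v : Fin n) (m : MedianDef.IsMedian g ρ v) where
  open TreeOn T

  r1 r2 r3 : Fin n
  r1 = ρ zero
  r2 = ρ (suc zero)
  r3 = ρ (suc (suc zero))

  X : Fin n → Bool
  X = coreSet g v r1 r2

  branch-connected : ∀ r {x y} → branchSet g v r x ≡ true → branchSet g v r y ≡ true → Path (restrict g (branchSet g v r)) x y
  branch-connected r hx hy = toR hx ++ₚ reversePath (restrict-symm {g = g} {s = branchSet g v r} symm) (toR hy)
    where
      cl : ∀ {y z} → Edge (delete g v) y z → branchSet g v r y ≡ true → branchSet g v r z ≡ true × Edge (restrict g (branchSet g v r)) y z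
      cl e hy = let hz = branchSet-forward {g = g} symm e hy in hz , restrict-intro {g = g} {s = branchSet g v r} (delete-⊆ {g = g} {v = v} e) hy hz
      toR : ∀ {x} → branchSet g v r x ≡ true → Path (restrict g (branchSet g v r)) x r
      toR hx = proj₁ (carryPath (λ y → branchSet g v r y ≡ true) cl hx (proj₂ (branchSet-elim {g = g} hx)))

  coreSet-forward : ∀ {y z} → Edge (delete g v) y z → X y ≡ true → X z ≡ true
  coreSet-forward e hy with ∧-elim {not (branchSet g v r1 _)} hy
  ... | a , b = ∧-intro (⇒not-true (λ h → not-true⇒ a (branchSet-backward {g = g} e h))) (⇒not-true (λ h → not-true⇒ b (branchSet-backward {g = g} e h)))

  core-connected : ∀ {x y} → X x ≡ true → X y ≡ true → Path (restrict g X) x y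
  core-connected hx hy = toV hx ++ₚ reversePath (restrict-symm {g = g} {s = X} symm) (toV hy)
    where
      toV : ∀ {x} → X x ≡ true → Path (restrict g X) x v
      toV {x} hx = go (x ≟ v)
        where
          go : Dec (x ≡ v) → Path (restrict g X) x v
          go (yes refl) = stop
          go (no xv) with TreeFacts.branchOf T {v} {x} tt tt xv
          ... | u , evu , wux with carryPath (λ y → X y ≡ true)
                  (λ e hy → let hz = coreSet-forward e hy in hz , restrict-intro {g = g} {s = X} (delete-⊆ {g = g} {v = v} e) hy hz)
                  hx (reversePath (TreeFacts.delete-symm T) wux)
          ... | w , hu = w ++ₚ edgePath (restrict-intro {g = g} {s = X} (symm evu) hu (coreSet-centre {g = g} {v} {r1} {r2}))

  coreTree : TreeOn (λ x → X x ≡ true) (restrict g X)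
  coreTree = restrict-TreeOn T X core-connected

  branchTree : ∀ r → TreeOn (λ x → branchSet g v r x ≡ true) (restrict g (branchSet g v r))
  branchTree r = restrict-TreeOn T (branchSet g v r) (branch-connected r)

  branches-disjoint : ∀ x → branchSet g v r1 x ≡ true → branchSet g v r2 x ≡ true → ⊥
  branches-disjoint x h1 h2 with branchSet-elim {g = g} h1 | branchSet-elim {g = g} h2
  ... | xv , w1 | _ , w2 with m zero (suc zero) (λ ())
  ... | inj₁ e = ¬pathToDeleted xv (subst (Path (delete g v) x) e w1)
  ... | inj₂ (inj₁ e) = ¬pathToDeleted xv (subst (Path (delete g v) x) e w2)
  ... | inj₂ (inj₂ nw) = nw (reversePath (TreeFacts.delete-symm T) w1 ++ₚ w2)

  root₃∉branch : ∀ (k : Fin 3) → k ≢ suc (suc zero) → branchSet g v (ρ k) r3 ≢ true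
  root₃∉branch k k2 h with branchSet-elim {g = g} h
  ... | r3v , w with m k (suc (suc zero)) k2
  ... | inj₁ e = ¬pathToDeleted r3v (subst (Path (delete g v) r3) e w)
  ... | inj₂ (inj₁ e) = r3v e
  ... | inj₂ (inj₂ nw) = nw (reversePath (TreeFacts.delete-symm T) w)

  root₃∈core : X r3 ≡ true
  root₃∈core = ∧-intro (⇒not-true (root₃∉branch zero (λ ()))) (⇒not-true (root₃∉branch (suc zero) (λ ())))

  neighbour∈branch : ∀ {r p} → Edge g v p → Path (delete g v) p r → branchSet g v r p ≡ true
  neighbour∈branch e w = branchSet-intro (λ q → TreeFacts.edge⇒≢ T e (sym q)) w

  root∈branch : ∀ {r} → r ≢ v → branchSet g v r r ≡ true
  root∈branch ne = branchSet-intro ne stop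

branch∧branch : ∀ a b → (a ≡ true → b ≡ true → ⊥) → a ∧ b ≡ false
branch∧branch true true h = ⊥-elim (h refl refl)
branch∧branch true false h = refl
branch∧branch false b h = refl

module _ {n : ℕ} where

  triple : Fin n → Fin n → Fin n → Fin 3 → Fin n
  triple a b c zero = a
  triple a b c (suc zero) = b
  triple a b c (suc (suc zero)) = c

  emptyBranch : ∀ {g : Graph n} {v} (r : Fin n) → r ≡ v → toSubset (branchSet g v r) ≡ EmptySet
  emptyBranch r refl = vec-ext _ _ (λ x → trans (lookup-toSubset _ x) (trans (branchSet-of-centre x) (sym (lookup-∅ x))))

  toSubset-∈ : ∀ {f : Fin n → Bool} {x} → f x ≡ true → x ∈ toSubset f
  toSubset-∈ {f} {x} h = inSet⇒∈ (trans (lookup-toSubset f x) h)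

  cutBranch₁ : (A : Adj n) .(it : IsTree FullSet A) (ρ : Fin 3 → Fin n) (v : Fin n) .(m : MedianDef.IsMedian (adj A) ρ v) →
        Dec (ρ zero ≡ v) → DRTree? n (toSubset (branchSet (adj A) v (ρ zero)))
  cutBranch₁ A it ρ v m (yes e) = empty (emptyBranch _ e)
  cutBranch₁ A it ρ v m (no ne) = tree (record
     { edges = toAdj (restrict (adj A) (branchSet (adj A) v (ρ zero)))
     ; isTree = TreeOn⇒isTree (TreeOn-toSubset (CutFacts.branchTree (fullTreeOn it) ρ v m (ρ zero)))
                      (ρ zero , toSubset-∈ (CutFacts.root∈branch (fullTreeOn it) ρ v m ne))
     ; root₁ = ρ zero
     ; root₂ = proj₁ nb
     ; root₁∈ = toSubset-∈ (CutFacts.root∈branch (fullTreeOn it) ρ v m ne)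
     ; root₂∈ = toSubset-∈ (CutFacts.neighbour∈branch (fullTreeOn it) ρ v m (proj₁ (proj₂ nb)) (proj₂ (proj₂ nb)))
     })
    where
      nb : Σ (Fin n) (λ u → Edge (adj A) v u × Path (delete (adj A) v) u (ρ zero))
      nb = findNeighbour (adj A) (fullTreeOn it) v (ρ zero) ne

  cutBranch₂ : (A : Adj n) .(it : IsTree FullSet A) (ρ : Fin 3 → Fin n) (v : Fin n) .(m : MedianDef.IsMedian (adj A) ρ v) →
        Dec (ρ (suc zero) ≡ v) → DRTree? n (toSubset (branchSet (adj A) v (ρ (suc zero))))
  cutBranch₂ A it ρ v m (yes e) = empty (emptyBranch _ e)
  cutBranch₂ A it ρ v m (no ne) = tree (record
     { edges = toAdj (restrict (adj A) (branchSet (adj A) v (ρ (suc zero))))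
     ; isTree = TreeOn⇒isTree (TreeOn-toSubset (CutFacts.branchTree (fullTreeOn it) ρ v m (ρ (suc zero))))
                      (ρ (suc zero) , toSubset-∈ (CutFacts.root∈branch (fullTreeOn it) ρ v m ne))
     ; root₁ = proj₁ nb
     ; root₂ = ρ (suc zero)
     ; root₁∈ = toSubset-∈ (CutFacts.neighbour∈branch (fullTreeOn it) ρ v m (proj₁ (proj₂ nb)) (proj₂ (proj₂ nb)))
     ; root₂∈ = toSubset-∈ (CutFacts.root∈branch (fullTreeOn it) ρ v m ne)
     })
    where
      nb : Σ (Fin n) (λ u → Edge (adj A) v u × Path (delete (adj A) v) u (ρ (suc zero)))
      nb = findNeighbour (adj A) (fullTreeOn it) v (ρ (suc zero)) ne

  cutCore : (A : Adj n) .(it : IsTree FullSet A) (ρ : Fin 3 → Fin n) (v : Fin n) .(m : MedianDef.IsMedian (adj A) ρ v) →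
        DRTree n (toSubset (coreSet (adj A) v (ρ zero) (ρ (suc zero))))
  cutCore A it ρ v m = record
        { edges = toAdj (restrict (adj A) (coreSet (adj A) v (ρ zero) (ρ (suc zero))))
        ; isTree = TreeOn⇒isTree (TreeOn-toSubset (CutFacts.coreTree (fullTreeOn it) ρ v m)) (v , toSubset-∈ (coreSet-centre {g = adj A} {v} {ρ zero} {ρ (suc zero)}))
        ; root₁ = v
        ; root₂ = ρ (suc (suc zero))
        ; root₁∈ = toSubset-∈ (coreSet-centre {g = adj A} {v} {ρ zero} {ρ (suc zero)})
        ; root₂∈ = toSubset-∈ (CutFacts.root₃∈core (fullTreeOn it) ρ v m)
        }

  cutAt : (A : Adj n) .(it : IsTree FullSet A) (ρ : Fin 3 → Fin n) (v : Fin n) .(m : MedianDef.IsMedian (adj A) ρ v) → QTriple n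
  cutAt A it ρ v m = record
    { X = toSubset Xf ; Y = toSubset Yf ; Z = toSubset Zf
    ; disjXY = toSubset-disjoint Xf Yf (λ x → core∧branch₁ (Yf x) (Zf x))
    ; disjXZ = toSubset-disjoint Xf Zf (λ x → core∧branch₂ (Yf x) (Zf x))
    ; disjYZ = toSubset-disjoint Yf Zf (λ x → branch∧branch (Yf x) (Zf x) (CutFacts.branches-disjoint (fullTreeOn it) ρ v m x))
    ; cover = toSubset-cover Xf Yf Zf (λ x → core∨branches (Yf x) (Zf x))
    ; Xne = v , toSubset-∈ (coreSet-centre {g = adj A} {v} {ρ zero} {ρ (suc zero)})
    ; D = cutCore A it ρ v m
    ; D′ = cutBranch₁ A it ρ v m (ρ zero ≟ v)
    ; D″ = cutBranch₂ A it ρ v m (ρ (suc zero) ≟ v)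
    }
    where
      Xf Yf Zf : Fin n → Bool
      Xf = coreSet (adj A) v (ρ zero) (ρ (suc zero))
      Yf = branchSet (adj A) v (ρ zero)
      Zf = branchSet (adj A) v (ρ (suc zero))

  cut : TRTree n → QTriple n
  cut record { edges = A ; isTree = it ; root₁ = a ; root₂ = b ; root₃ = c } =
    cutAt A it (triple a b c) (proj₁ (findMedian (adj A) (triple a b c) (fullTreeOn it)))
                          (proj₂ (findMedian (adj A) (triple a b c) (fullTreeOn it)))

module _ {n : ℕ} where

  bridge : Fin n → Fin n → Graph n
  bridge s t i j = (⌊ i ≟ s ⌋ ∧ ⌊ j ≟ t ⌋) ∨ (⌊ i ≟ t ⌋ ∧ ⌊ j ≟ s ⌋)

  bridge-elim : ∀ {s t i j} → bridge s t i j ≡ true → (i ≡ s × j ≡ t) ⊎ (i ≡ t × j ≡ s)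
  bridge-elim {s} {t} {i} {j} e with ∨-elim {⌊ i ≟ s ⌋ ∧ ⌊ j ≟ t ⌋} e
  ... | inj₁ a = let (p , q) = ∧-elim {⌊ i ≟ s ⌋} a in inj₁ (isYes⇒ (i ≟ s) p , isYes⇒ (j ≟ t) q)
  ... | inj₂ b = let (p , q) = ∧-elim {⌊ i ≟ t ⌋} b in inj₂ (isYes⇒ (i ≟ t) p , isYes⇒ (j ≟ s) q)

  bridge-intro : ∀ {s t} → bridge s t s t ≡ true
  bridge-intro {s} {t} = ∨-introˡ (∧-intro (⇒isYes (s ≟ s) refl) (⇒isYes (t ≟ t) refl))

  bridge-intro′ : ∀ {s t} → bridge s t t s ≡ true
  bridge-intro′ {s} {t} = ∨-introʳ {⌊ t ≟ s ⌋ ∧ ⌊ s ≟ t ⌋} (∧-intro (⇒isYes (t ≟ t) refl) (⇒isYes (s ≟ s) refl))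

  ∨-edgeCases : ∀ {p q : Graph n} {s t i j} → Edge (λ i j → p i j ∨ (q i j ∨ bridge s t i j)) i j →
         Edge p i j ⊎ Edge q i j ⊎ (i ≡ s × j ≡ t) ⊎ (i ≡ t × j ≡ s)
  ∨-edgeCases {p} {q} {s} {t} {i} {j} ⟨ e ⟩ with ∨-elim {p i j} e
  ... | inj₁ a = inj₁ ⟨ a ⟩
  ... | inj₂ b with ∨-elim {q i j} b
  ... | inj₁ c = inj₂ (inj₁ ⟨ c ⟩)
  ... | inj₂ c = inj₂ (inj₂ (bridge-elim c))

  attach₁ : ∀ {Y : Subset n} → DRTree? n Y → Fin n → Graph n
  attach₁ (empty _) a i j = false
  attach₁ (tree D) a i j = adj (DRTree.edges D) i j ∨ bridge (DRTree.root₂ D) a i j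

  attach₂ : ∀ {Z : Subset n} → DRTree? n Z → Fin n → Graph n
  attach₂ (empty _) a i j = false
  attach₂ (tree D) a i j = adj (DRTree.edges D) i j ∨ bridge a (DRTree.root₁ D) i j

  -- The first and second root of the glued tree; a stands for the first root of D.
  outerRoot₁ : ∀ {Y : Subset n} → DRTree? n Y → Fin n → Fin n
  outerRoot₁ (empty _) a = a
  outerRoot₁ (tree D) a = DRTree.root₁ D

  outerRoot₂ : ∀ {Z : Subset n} → DRTree? n Z → Fin n → Fin n
  outerRoot₂ (empty _) a = a
  outerRoot₂ (tree D) a = DRTree.root₂ D

  glue : ∀ {X Y Z : Subset n} → DRTree n X → DRTree? n Y → DRTree? n Z → Graph n
  glue D D' D'' i j = (adj (DRTree.edges D) i j ∨ attach₁ D' (DRTree.root₁ D) i j) ∨ attach₂ D'' (DRTree.root₁ D) i j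

  inSet? : ∀ (S : Subset n) x → Dec (inSet S x)
  inSet? S x = lookup S x B.≟ true

  TreeOn? : ∀ {S : Subset n} → DRTree? n S → Set
  TreeOn? (empty _) = ⊤
  TreeOn? {S} (tree R) = TreeOn (inSet S) (adj (DRTree.edges R))

  root₁-inSet : ∀ {S : Subset n} (R : DRTree n S) → inSet S (DRTree.root₁ R)
  root₁-inSet {S} record { root₁ = r ; root₁∈ = p } = recompute (inSet? S r) (∈⇒inSet p)

  root₂-inSet : ∀ {S : Subset n} (R : DRTree n S) → inSet S (DRTree.root₂ R)
  root₂-inSet {S} record { root₂ = r ; root₂∈ = p } = recompute (inSet? S r) (∈⇒inSet p)

  drTreeOn : ∀ {S : Subset n} (R : DRTree n S) → TreeOn (inSet S) (adj (DRTree.edges R))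
  drTreeOn record { isTree = t } = isTree⇒TreeOn (isTree-recompute t)

  treeOn? : ∀ {S : Subset n} (Q : DRTree? n S) → TreeOn? Q
  treeOn? (empty _) = tt
  treeOn? (tree R) = drTreeOn R

-- The glued graph is a tree: D and D′ are joined by one edge, and the result
-- and D″ by another.
module GlueFacts {n : ℕ} {X Y Z : Subset n} (D : DRTree n X) (D' : DRTree? n Y) (D'' : DRTree? n Z)
    (dXY : ∀ {x} → inSet X x → inSet Y x → ⊥) (dXZ : ∀ {x} → inSet X x → inSet Z x → ⊥)
    (dYZ : ∀ {x} → inSet Y x → inSet Z x → ⊥) (cov : ∀ x → inSet X x ⊎ inSet Y x ⊎ inSet Z x)
    where

  TD : TreeOn (inSet X) (adj (DRTree.edges D))
  TD = drTreeOn D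

  TY : TreeOn? D'
  TY = treeOn? D'

  TZ : TreeOn? D''
  TZ = treeOn? D''

  a : Fin n
  a = DRTree.root₁ D

  aX : inSet X a
  aX = root₁-inSet D

  gD : Graph n
  gD = adj (DRTree.edges D)

  treeXY : (Q : DRTree? n Y) → TreeOn? Q → TreeOn (λ x → inSet X x ⊎ inSet Y x) (λ i j → gD i j ∨ attach₁ Q a i j)
  treeXY (empty p) _ = TreeOn-cong TD inj₁ (λ { (inj₁ x) → x ; (inj₂ y) → ⊥-elim (empty⇒ p y) })
                   (λ i j → sym (BP.∨-identityʳ _))
  treeXY (tree Q) TQ = TreeOn-cong (Join.joined gY gD joinedY (inSet Y) (inSet X) (inSet? Y) (inSet? X) d a TQ TD
                    (λ y x → dXY x y) (root₂-inSet Q) aX edgeCases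
                    (λ e → ⟨ ∨-introʳ {gD _ _} (∨-introˡ (holds e)) ⟩) (λ e → ⟨ ∨-introˡ (holds e) ⟩)
                    ⟨ ∨-introʳ {gD d a} (∨-introʳ {gY d a} (bridge-intro {s = d} {t = a})) ⟩ ⟨ ∨-introʳ {gD a d} (∨-introʳ {gY a d} (bridge-intro′ {s = d} {t = a})) ⟩)
                  (λ { (inj₁ y) → inj₂ y ; (inj₂ x) → inj₁ x })
                  (λ { (inj₁ x) → inj₂ x ; (inj₂ y) → inj₁ y }) (λ _ _ → refl)
    where
      gY : Graph n
      gY = adj (DRTree.edges Q)
      d : Fin n
      d = DRTree.root₂ Q
      joinedY : Graph n
      joinedY i j = gD i j ∨ (gY i j ∨ bridge d a i j)
      edgeCases : ∀ {i j} → Edge joinedY i j → Edge gY i j ⊎ Edge gD i j ⊎ (i ≡ d × j ≡ a) ⊎ (i ≡ a × j ≡ d)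
      edgeCases e with ∨-edgeCases {p = gD} {q = gY} e
      ... | inj₁ x = inj₂ (inj₁ x)
      ... | inj₂ (inj₁ x) = inj₁ x
      ... | inj₂ (inj₂ x) = inj₂ (inj₂ x)

  graphXY : Graph n
  graphXY i j = gD i j ∨ attach₁ D' a i j

  treeXYZ : (Q : DRTree? n Z) → TreeOn? Q → TreeOn (λ x → (inSet X x ⊎ inSet Y x) ⊎ inSet Z x) (λ i j → graphXY i j ∨ attach₂ Q a i j)
  treeXYZ (empty p) _ = TreeOn-cong (treeXY D' TY) inj₁ (λ { (inj₁ x) → x ; (inj₂ z) → ⊥-elim (empty⇒ p z) })
                   (λ i j → sym (BP.∨-identityʳ _))
  treeXYZ (tree Q) TQ = Join.joined graphXY gZ joinedZ (λ x → inSet X x ⊎ inSet Y x) (inSet Z)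
                    (λ x → inSet? X x ⊎-dec inSet? Y x) (inSet? Z) a ee (treeXY D' TY) TQ
                    (λ { (inj₁ x) z → dXZ x z ; (inj₂ y) z → dYZ y z }) (inj₁ aX) (root₁-inSet Q) (∨-edgeCases {p = graphXY} {q = gZ})
                    (λ e → ⟨ ∨-introˡ (holds e) ⟩) (λ e → ⟨ ∨-introʳ {graphXY _ _} (∨-introˡ (holds e)) ⟩)
                    ⟨ ∨-introʳ {graphXY a ee} (∨-introʳ {gZ a ee} (bridge-intro {s = a} {t = ee})) ⟩ ⟨ ∨-introʳ {graphXY ee a} (∨-introʳ {gZ ee a} (bridge-intro′ {s = a} {t = ee})) ⟩
    where
      gZ : Graph n
      gZ = adj (DRTree.edges Q)
      ee : Fin n
      ee = DRTree.root₁ Q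
      joinedZ : Graph n
      joinedZ i j = graphXY i j ∨ (gZ i j ∨ bridge a ee i j)

  glue-TreeOn : TreeOn (λ _ → ⊤) (glue D D' D'')
  glue-TreeOn = TreeOn-cong (treeXYZ D'' TZ) (λ _ → tt) fromCov (λ _ _ → refl)
    where
      fromCov : ∀ {x} → ⊤ → (inSet X x ⊎ inSet Y x) ⊎ inSet Z x
      fromCov {x} _ with cov x
      ... | inj₁ p = inj₁ (inj₁ p)
      ... | inj₂ (inj₁ p) = inj₁ (inj₂ p)
      ... | inj₂ (inj₂ p) = inj₂ p

module _ {n : ℕ} where

  gluedAdj : ∀ {X Y Z : Subset n} → DRTree n X → DRTree? n Y → DRTree? n Z → Adj n
  gluedAdj D D' D'' = toAdj (glue D D' D'')

  glue-isTree : ∀ {X Y Z : Subset n} (D : DRTree n X) (D' : DRTree? n Y) (D'' : DRTree? n Z) →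
       .(X ∩ Y ≡ EmptySet) → .(X ∩ Z ≡ EmptySet) → .(Y ∩ Z ≡ EmptySet) → .(X ∪ (Y ∪ Z) ≡ FullSet) →
       IsTree FullSet (gluedAdj D D' D'')
  glue-isTree D D' D'' dxy dxz dyz cv =
    TreeOn⇒isTree
      (TreeOn-cong (GlueFacts.glue-TreeOn D D' D'' (disjoint⇒ dxy) (disjoint⇒ dxz) (disjoint⇒ dyz) (cover⇒ cv))
        (λ {x} _ → lookup-full x) (λ _ → tt) (λ i j → sym (adj-toAdj _ i j)))
      (DRTree.root₁ D , SSP.∈⊤)

  glued : ∀ {X Y Z : Subset n} (D : DRTree n X) (D' : DRTree? n Y) (D'' : DRTree? n Z) →
        .(IsTree FullSet (toAdj (glue D D' D''))) → TRTree n
  glued D D' D'' it = record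
    { edges = toAdj (glue D D' D'')
    ; isTree = it
    ; root₁ = outerRoot₁ D' (DRTree.root₁ D)
    ; root₂ = outerRoot₂ D'' (DRTree.root₁ D)
    ; root₃ = DRTree.root₂ D
    }

  glueAll : QTriple n → TRTree n
  glueAll record { disjXY = dxy ; disjXZ = dxz ; disjYZ = dyz ; cover = cv ; D = D ; D′ = D' ; D″ = D'' } =
    glued D D' D'' (glue-isTree D D' D'' dxy dxz dyz cv)

bool-ext : ∀ {a b} → (a ≡ true → b ≡ true) → (b ≡ true → a ≡ true) → a ≡ b
bool-ext {true} f g = sym (f refl)
bool-ext {false} {true} f g = g refl
bool-ext {false} {false} f g = refl

module _ {n : ℕ} where

  TRTree-ext : (t t' : TRTree n) → TRTree.edges t ≡ TRTree.edges t' → TRTree.root₁ t ≡ TRTree.root₁ t' →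
          TRTree.root₂ t ≡ TRTree.root₂ t' → TRTree.root₃ t ≡ TRTree.root₃ t' → t ≡ t'
  TRTree-ext record {} record {} refl refl refl refl = refl

  toAdj-ext : ∀ (f : Graph n) (A : Adj n) → (∀ i j → f i j ≡ adj A i j) → toAdj f ≡ A
  toAdj-ext f A h = vec-ext _ _ (λ i → trans (VP.lookup∘tabulate _ i)
                     (vec-ext _ _ (λ j → trans (VP.lookup∘tabulate _ j) (h i j))))

module GlueAfterCut {n : ℕ} (A : Adj n) .(it : IsTree FullSet A)
           (ρ : Fin 3 → Fin n) (v : Fin n) (m : MedianDef.IsMedian (adj A) ρ v) where
  g : Graph n
  g = adj A

  T : TreeOn (λ _ → ⊤) g
  T = fullTreeOn it

  open CutFacts T ρ v m
  open TreeOn T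

  Yf Zf : Fin n → Bool
  Yf = branchSet g v r1
  Zf = branchSet g v r2

  partition : ∀ x → X x ≡ true ⊎ Yf x ≡ true ⊎ Zf x ≡ true
  partition x with Yf x | Zf x
  ... | true | _ = inj₂ (inj₁ refl)
  ... | false | true = inj₂ (inj₂ refl)
  ... | false | false = inj₁ refl

  restrict⇒edge : ∀ {s : Fin n → Bool} i j → adj (toAdj (restrict g s)) i j ≡ true → Edge g i j
  restrict⇒edge {s} i j h = proj₁ (restrict-elim {g = g} {s = s} ⟨ trans (sym (adj-toAdj _ i j)) h ⟩)

  edge⇒restrict : ∀ {s : Fin n → Bool} i j → Edge g i j → s i ≡ true → s j ≡ true → adj (toAdj (restrict g s)) i j ≡ true
  edge⇒restrict {s} i j e a b = trans (adj-toAdj _ i j) (holds (restrict-intro {g = g} {s = s} e a b))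

  emptyBranch-elim : ∀ {r x} → r ≡ v → branchSet g v r x ≢ true
  emptyBranch-elim {x = x} refl h = false≢true (trans (sym (branchSet-of-centre {g = g} x)) h)

  Dm : DRTree n (toSubset X)
  Dm = cutCore A it ρ v m

  Ym : Dec (r1 ≡ v) → DRTree? n (toSubset Yf)
  Ym d = cutBranch₁ A it ρ v m d

  Zm : Dec (r2 ≡ v) → DRTree? n (toSubset Zf)
  Zm d = cutBranch₂ A it ρ v m d

  nb₁ : r1 ≢ v → Σ (Fin n) (λ u → Edge g v u × Path (delete g v) u r1)
  nb₁ ne = findNeighbour g T v r1 ne

  nb₂ : r2 ≢ v → Σ (Fin n) (λ u → Edge g v u × Path (delete g v) u r2)
  nb₂ ne = findNeighbour g T v r2 ne

  attach₁-edge : ∀ d i j → attach₁ (Ym d) v i j ≡ true → Edge g i j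
  attach₁-edge (yes _) i j ()
  attach₁-edge (no ne) i j h with ∨-elim {adj (toAdj (restrict g Yf)) i j} h
  ... | inj₁ a = restrict⇒edge {s = Yf} i j a
  ... | inj₂ b with bridge-elim {s = proj₁ (nb₁ ne)} {t = v} {i} {j} b
  ... | inj₁ (refl , refl) = symm (proj₁ (proj₂ (nb₁ ne)))
  ... | inj₂ (refl , refl) = proj₁ (proj₂ (nb₁ ne))

  attach₂-edge : ∀ d i j → attach₂ (Zm d) v i j ≡ true → Edge g i j
  attach₂-edge (yes _) i j ()
  attach₂-edge (no ne) i j h with ∨-elim {adj (toAdj (restrict g Zf)) i j} h
  ... | inj₁ a = restrict⇒edge {s = Zf} i j a
  ... | inj₂ b with bridge-elim {s = v} {t = proj₁ (nb₂ ne)} {i} {j} b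
  ... | inj₁ (refl , refl) = proj₁ (proj₂ (nb₂ ne))
  ... | inj₂ (refl , refl) = symm (proj₁ (proj₂ (nb₂ ne)))

  attach₁-intro : ∀ d {i j} → Edge g i j → Yf i ≡ true → Yf j ≡ true → attach₁ (Ym d) v i j ≡ true
  attach₁-intro (yes e) _ yi _ = ⊥-elim (emptyBranch-elim e yi)
  attach₁-intro (no ne) {i} {j} e yi yj = ∨-introˡ (edge⇒restrict {s = Yf} i j e yi yj)

  attach₂-intro : ∀ d {i j} → Edge g i j → Zf i ≡ true → Zf j ≡ true → attach₂ (Zm d) v i j ≡ true
  attach₂-intro (yes e) _ zi _ = ⊥-elim (emptyBranch-elim e zi)
  attach₂-intro (no ne) {i} {j} e zi zj = ∨-introˡ (edge⇒restrict {s = Zf} i j e zi zj)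

  neighbour-unique : ∀ {r u p} → Edge g v u → branchSet g v r u ≡ true → Edge g v p → Path (delete g v) p r → u ≡ p
  neighbour-unique eu yu ep wp = TreeFacts.branchNeighbour-unique T eu ep (proj₂ (branchSet-elim {g = g} yu)) wp

  attach₁-bridge : ∀ d {i} → Edge g v i → Yf i ≡ true → attach₁ (Ym d) v i v ≡ true
  attach₁-bridge (yes e) _ yi = ⊥-elim (emptyBranch-elim e yi)
  attach₁-bridge (no ne) {i} ei yi with neighbour-unique ei yi (proj₁ (proj₂ (nb₁ ne))) (proj₂ (proj₂ (nb₁ ne)))
  ... | refl = ∨-introʳ {adj (toAdj (restrict g Yf)) i v} (bridge-intro {s = i} {t = v})

  attach₁-bridge′ : ∀ d {j} → Edge g v j → Yf j ≡ true → attach₁ (Ym d) v v j ≡ true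
  attach₁-bridge′ (yes e) _ yj = ⊥-elim (emptyBranch-elim e yj)
  attach₁-bridge′ (no ne) {j} ej yj with neighbour-unique ej yj (proj₁ (proj₂ (nb₁ ne))) (proj₂ (proj₂ (nb₁ ne)))
  ... | refl = ∨-introʳ {adj (toAdj (restrict g Yf)) v j} (bridge-intro′ {s = j} {t = v})

  attach₂-bridge : ∀ d {j} → Edge g v j → Zf j ≡ true → attach₂ (Zm d) v v j ≡ true
  attach₂-bridge (yes e) _ zj = ⊥-elim (emptyBranch-elim e zj)
  attach₂-bridge (no ne) {j} ej zj with neighbour-unique ej zj (proj₁ (proj₂ (nb₂ ne))) (proj₂ (proj₂ (nb₂ ne)))
  ... | refl = ∨-introʳ {adj (toAdj (restrict g Zf)) v j} (bridge-intro {s = v} {t = j})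

  attach₂-bridge′ : ∀ d {i} → Edge g v i → Zf i ≡ true → attach₂ (Zm d) v i v ≡ true
  attach₂-bridge′ (yes e) _ zi = ⊥-elim (emptyBranch-elim e zi)
  attach₂-bridge′ (no ne) {i} ei zi with neighbour-unique ei zi (proj₁ (proj₂ (nb₂ ne))) (proj₂ (proj₂ (nb₂ ne)))
  ... | refl = ∨-introʳ {adj (toAdj (restrict g Zf)) i v} (bridge-intro′ {s = v} {t = i})

  -- The glued graph equals the original one: an edge lies in the core, inside a
  -- branch, or joins v to the unique neighbour of v in a branch.
  glue-cut-edges : ∀ d d' i j → glue Dm (Ym d) (Zm d') i j ≡ g i j
  glue-cut-edges d d' i j = bool-ext fw (λ e → bw ⟨ e ⟩ (i ≟ v) (j ≟ v))
    where
      G1 : Bool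
      G1 = adj (toAdj (restrict g X)) i j
      fw : glue Dm (Ym d) (Zm d') i j ≡ true → g i j ≡ true
      fw h with ∨-elim {G1 ∨ attach₁ (Ym d) v i j} h
      ... | inj₂ c = holds (attach₂-edge d' i j c)
      ... | inj₁ a with ∨-elim {G1} a
      ... | inj₁ b = holds (restrict⇒edge {s = X} i j b)
      ... | inj₂ b = holds (attach₁-edge d i j b)
      inD : Edge g i j → X i ≡ true → X j ≡ true → glue Dm (Ym d) (Zm d') i j ≡ true
      inD e xi xj = ∨-introˡ (∨-introˡ (edge⇒restrict {s = X} i j e xi xj))
      inY : attach₁ (Ym d) v i j ≡ true → glue Dm (Ym d) (Zm d') i j ≡ true
      inY h = ∨-introˡ (∨-introʳ {G1} h)
      inZ : attach₂ (Zm d') v i j ≡ true → glue Dm (Ym d) (Zm d') i j ≡ true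
      inZ h = ∨-introʳ {G1 ∨ attach₁ (Ym d) v i j} h
      bw : Edge g i j → Dec (i ≡ v) → Dec (j ≡ v) → glue Dm (Ym d) (Zm d') i j ≡ true
      bw e (yes refl) (yes refl) = ⊥-elim (irrefl e)
      bw e (no iv) (no jv) with partition i
      ... | inj₁ xi = inD e xi (coreSet-forward ed xi)
        where ed = delete-intro {g = g} {v = v} e iv jv
      ... | inj₂ (inj₁ yi) = inY (attach₁-intro d e yi (branchSet-forward {g = g} symm (delete-intro {g = g} {v = v} e iv jv) yi))
      ... | inj₂ (inj₂ zi) = inZ (attach₂-intro d' e zi (branchSet-forward {g = g} symm (delete-intro {g = g} {v = v} e iv jv) zi))
      bw e (yes refl) (no jv) with partition j
      ... | inj₁ xj = inD e (coreSet-centre {g = g} {v} {r1} {r2}) xj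
      ... | inj₂ (inj₁ yj) = inY (attach₁-bridge′ d e yj)
      ... | inj₂ (inj₂ zj) = inZ (attach₂-bridge d' e zj)
      bw e (no iv) (yes refl) with partition i
      ... | inj₁ xi = inD e xi (coreSet-centre {g = g} {v} {r1} {r2})
      ... | inj₂ (inj₁ yi) = inY (attach₁-bridge d (symm e) yi)
      ... | inj₂ (inj₂ zi) = inZ (attach₂-bridge′ d' (symm e) zi)

module _ {n : ℕ} where
  outerRoot₁-cut : ∀ (A : Adj n) .(it : IsTree FullSet A) ρ v .(m : MedianDef.IsMedian (adj A) ρ v) (d : Dec (ρ zero ≡ v)) →
         outerRoot₁ (cutBranch₁ A it ρ v m d) v ≡ ρ zero
  outerRoot₁-cut A it ρ v m (yes e) = sym e
  outerRoot₁-cut A it ρ v m (no _) = refl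

  outerRoot₂-cut : ∀ (A : Adj n) .(it : IsTree FullSet A) ρ v .(m : MedianDef.IsMedian (adj A) ρ v) (d : Dec (ρ (suc zero) ≡ v)) →
         outerRoot₂ (cutBranch₂ A it ρ v m d) v ≡ ρ (suc zero)
  outerRoot₂-cut A it ρ v m (yes e) = sym e
  outerRoot₂-cut A it ρ v m (no _) = refl

  glue∘cut : ∀ (t : TRTree n) → glueAll (cut t) ≡ t
  glue∘cut t@(record { edges = A ; isTree = it ; root₁ = a ; root₂ = b ; root₃ = c }) =
    TRTree-ext (glueAll (cut t)) t
      (toAdj-ext _ A (GlueAfterCut.glue-cut-edges A it (triple a b c) v m (a ≟ v) (b ≟ v)))
      (outerRoot₁-cut A it (triple a b c) v m (a ≟ v))
      (outerRoot₂-cut A it (triple a b c) v m (b ≟ v))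
      refl
    where
      v : Fin n
      v = proj₁ (findMedian (adj A) (triple a b c) (fullTreeOn it))
      m : MedianDef.IsMedian (adj A) (triple a b c) v
      m = proj₂ (findMedian (adj A) (triple a b c) (fullTreeOn it))

module _ {n : ℕ} where

  edgesOf : ∀ {S : Subset n} → DRTree? n S → Graph n
  edgesOf (empty _) i j = false
  edgesOf (tree R) = adj (DRTree.edges R)

  edgesOf-inSet : ∀ {S : Subset n} (Q : DRTree? n S) → TreeOn? Q → ∀ {i j} → Edge (edgesOf Q) i j → inSet S i × inSet S j
  edgesOf-inSet (empty _) _ ()
  edgesOf-inSet (tree R) T e = TreeOn.edgeInS T e , TreeOn.edgeInS T (TreeOn.symm T e)

  attach₁-elim : ∀ {S : Subset n} (Q : DRTree? n S) a {i j} → attach₁ Q a i j ≡ true →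
             Edge (edgesOf Q) i j ⊎ (i ≡ a × inSet S j) ⊎ (j ≡ a × inSet S i)
  attach₁-elim (empty _) a ()
  attach₁-elim (tree R) a {i} {j} h with ∨-elim {adj (DRTree.edges R) i j} h
  ... | inj₁ x = inj₁ ⟨ x ⟩
  ... | inj₂ x with bridge-elim {s = DRTree.root₂ R} {t = a} {i} {j} x
  ... | inj₁ (refl , refl) = inj₂ (inj₂ (refl , root₂-inSet R))
  ... | inj₂ (refl , refl) = inj₂ (inj₁ (refl , root₂-inSet R))

  attach₂-elim : ∀ {S : Subset n} (Q : DRTree? n S) a {i j} → attach₂ Q a i j ≡ true →
             Edge (edgesOf Q) i j ⊎ (i ≡ a × inSet S j) ⊎ (j ≡ a × inSet S i)
  attach₂-elim (empty _) a ()
  attach₂-elim (tree R) a {i} {j} h with ∨-elim {adj (DRTree.edges R) i j} h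
  ... | inj₁ x = inj₁ ⟨ x ⟩
  ... | inj₂ x with bridge-elim {s = a} {t = DRTree.root₁ R} {i} {j} x
  ... | inj₁ (refl , refl) = inj₂ (inj₁ (refl , root₁-inSet R))
  ... | inj₂ (refl , refl) = inj₂ (inj₂ (refl , root₁-inSet R))

  attach₁-edgesOf : ∀ {S : Subset n} (Q : DRTree? n S) a {i j} → Edge (edgesOf Q) i j → attach₁ Q a i j ≡ true
  attach₁-edgesOf (empty _) a ()
  attach₁-edgesOf (tree R) a e = ∨-introˡ (holds e)

  attach₂-edgesOf : ∀ {S : Subset n} (Q : DRTree? n S) a {i j} → Edge (edgesOf Q) i j → attach₂ Q a i j ≡ true
  attach₂-edgesOf (empty _) a ()
  attach₂-edgesOf (tree R) a e = ∨-introˡ (holds e)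

  outerRoot₁-cases : ∀ {S : Subset n} (Q : DRTree? n S) a → outerRoot₁ Q a ≡ a ⊎ inSet S (outerRoot₁ Q a)
  outerRoot₁-cases (empty _) a = inj₁ refl
  outerRoot₁-cases (tree R) a = inj₂ (root₁-inSet R)

  outerRoot₂-cases : ∀ {S : Subset n} (Q : DRTree? n S) a → outerRoot₂ Q a ≡ a ⊎ inSet S (outerRoot₂ Q a)
  outerRoot₂-cases (empty _) a = inj₁ refl
  outerRoot₂-cases (tree R) a = inj₂ (root₂-inSet R)

-- Cutting a glued configuration: the first root a of D is the median of the
-- glued tree, and the branch sets, edges and roots found by the cut are the
-- original ones.
module CutAfterGlue {n : ℕ} {X Y Z : Subset n} (D : DRTree n X) (D' : DRTree? n Y) (D'' : DRTree? n Z)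
    (dXY : ∀ {x} → inSet X x → inSet Y x → ⊥) (dXZ : ∀ {x} → inSet X x → inSet Z x → ⊥)
    (dYZ : ∀ {x} → inSet Y x → inSet Z x → ⊥) (cov : ∀ x → inSet X x ⊎ inSet Y x ⊎ inSet Z x) where

  TD : TreeOn (inSet X) (adj (DRTree.edges D))
  TD = drTreeOn D

  TY : TreeOn? D'
  TY = treeOn? D'

  TZ : TreeOn? D''
  TZ = treeOn? D''

  a b : Fin n
  a = DRTree.root₁ D
  b = DRTree.root₂ D

  aX : inSet X a
  aX = root₁-inSet D

  bX : inSet X b
  bX = root₂-inSet D

  gD gl g : Graph n
  gD = adj (DRTree.edges D)
  gl = glue D D' D''
  g = adj (toAdj gl)

  TG : TreeOn (λ _ → ⊤) gl
  TG = GlueFacts.glue-TreeOn D D' D'' dXY dXZ dYZ cov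

  Tg : TreeOn (λ _ → ⊤) g
  Tg = TreeOn-cong TG (λ x → x) (λ x → x) (λ i j → sym (adj-toAdj gl i j))

  r1 r2 : Fin n
  r1 = outerRoot₁ D' a
  r2 = outerRoot₂ D'' a

  ρ : Fin 3 → Fin n
  ρ = triple r1 r2 b

  toG : ∀ {i j} → gl i j ≡ true → Edge g i j
  toG {i} {j} h = ⟨ trans (adj-toAdj gl i j) h ⟩

  aY : ∀ {x} → inSet Y x → x ≢ a
  aY yx refl = dXY aX yx

  aZ : ∀ {x} → inSet Z x → x ≢ a
  aZ zx refl = dXZ aX zx

  glued-edgeCases : ∀ {i j} → Edge g i j → Edge gD i j ⊎ Edge (edgesOf D') i j ⊎ Edge (edgesOf D'') i j ⊎
            ((i ≡ a × (inSet Y j ⊎ inSet Z j)) ⊎ (j ≡ a × (inSet Y i ⊎ inSet Z i)))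
  glued-edgeCases {i} {j} ⟨ e ⟩ with ∨-elim {gD i j ∨ attach₁ D' a i j} (trans (sym (adj-toAdj gl i j)) e)
  ... | inj₂ z with attach₂-elim D'' a z
  ... | inj₁ x = inj₂ (inj₂ (inj₁ x))
  ... | inj₂ (inj₁ (p , q)) = inj₂ (inj₂ (inj₂ (inj₁ (p , inj₂ q))))
  ... | inj₂ (inj₂ (p , q)) = inj₂ (inj₂ (inj₂ (inj₂ (p , inj₂ q))))
  glued-edgeCases {i} {j} ⟨ e ⟩ | inj₁ w with ∨-elim {gD i j} w
  ... | inj₁ x = inj₁ ⟨ x ⟩
  ... | inj₂ y with attach₁-elim D' a y
  ... | inj₁ x = inj₂ (inj₁ x)
  ... | inj₂ (inj₁ (p , q)) = inj₂ (inj₂ (inj₂ (inj₁ (p , inj₁ q))))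
  ... | inj₂ (inj₂ (p , q)) = inj₂ (inj₂ (inj₂ (inj₂ (p , inj₁ q))))

  deleted-edgeCases : ∀ {i j} → Edge (delete g a) i j → (inSet X i × inSet X j) ⊎ (inSet Y i × inSet Y j) ⊎ (inSet Z i × inSet Z j)
  deleted-edgeCases e with delete-elim {g = g} {v = a} e
  ... | e' , ia , ja with glued-edgeCases e'
  ... | inj₁ x = inj₁ (TreeOn.edgeInS TD x , TreeOn.edgeInS TD (TreeOn.symm TD x))
  ... | inj₂ (inj₁ x) = inj₂ (inj₁ (edgesOf-inSet D' TY x))
  ... | inj₂ (inj₂ (inj₁ x)) = inj₂ (inj₂ (edgesOf-inSet D'' TZ x))
  ... | inj₂ (inj₂ (inj₂ (inj₁ (p , _)))) = ⊥-elim (ia p)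
  ... | inj₂ (inj₂ (inj₂ (inj₂ (p , _)))) = ⊥-elim (ja p)

  P : Fin 3 → Fin n → Set
  P zero x = inSet Y x
  P (suc zero) x = inSet Z x
  P (suc (suc zero)) x = inSet X x × x ≢ a

  stay : ∀ k {y z} → Edge (delete g a) y z → P k y → P k z × Edge (delete g a) y z
  stay zero e py with deleted-edgeCases e
  ... | inj₁ (x , _) = ⊥-elim (dXY x py)
  ... | inj₂ (inj₁ (_ , q)) = q , e
  ... | inj₂ (inj₂ (z , _)) = ⊥-elim (dYZ py z)
  stay (suc zero) e py with deleted-edgeCases e
  ... | inj₁ (x , _) = ⊥-elim (dXZ x py)
  ... | inj₂ (inj₁ (y , _)) = ⊥-elim (dYZ y py)
  ... | inj₂ (inj₂ (_ , q)) = q , e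
  stay (suc (suc zero)) e py with deleted-edgeCases e
  ... | inj₁ (_ , q) = (q , proj₂ (proj₂ (delete-elim {g = g} {v = a} e))) , e
  ... | inj₂ (inj₁ (y , _)) = ⊥-elim (dXY (proj₁ py) y)
  ... | inj₂ (inj₂ (z , _)) = ⊥-elim (dXZ (proj₁ py) z)

  parts-disjoint : ∀ k l → k ≢ l → ∀ {x} → P k x → P l x → ⊥
  parts-disjoint zero zero kl _ _ = kl refl
  parts-disjoint zero (suc zero) _ p q = dYZ p q
  parts-disjoint zero (suc (suc zero)) _ p q = dXY (proj₁ q) p
  parts-disjoint (suc zero) zero _ p q = dYZ q p
  parts-disjoint (suc zero) (suc zero) kl _ _ = kl refl
  parts-disjoint (suc zero) (suc (suc zero)) _ p q = dXZ (proj₁ q) p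
  parts-disjoint (suc (suc zero)) zero _ p q = dXY (proj₁ p) q
  parts-disjoint (suc (suc zero)) (suc zero) _ p q = dXZ (proj₁ p) q
  parts-disjoint (suc (suc zero)) (suc (suc zero)) kl _ _ = kl refl

  root-part : ∀ k → ρ k ≡ a ⊎ P k (ρ k)
  root-part zero = outerRoot₁-cases D' a
  root-part (suc zero) = outerRoot₂-cases D'' a
  root-part (suc (suc zero)) with b ≟ a
  ... | yes e = inj₁ e
  ... | no ne = inj₂ (bX , ne)

  -- Hence a is a median, and by uniqueness the median.
  centre-isMedian : MedianDef.IsMedian g ρ a
  centre-isMedian i j ij with root-part i | root-part j
  ... | inj₁ e | _ = inj₁ e
  ... | inj₂ _ | inj₁ e = inj₂ (inj₁ e)
  ... | inj₂ pi | inj₂ pj = inj₂ (inj₂ (λ W → parts-disjoint i j ij (proj₂ (carryPath (P i) (stay i) pi W)) pj))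

  median≡centre : ∀ {v} → MedianDef.IsMedian g ρ v → v ≡ a
  median≡centre m = MedianFacts.median-unique Tg ρ m centre-isMedian

  partPath : ∀ {S : Subset n} (Q : DRTree? n S) → TreeOn? Q → (∀ {x} → inSet S x → x ≢ a) →
          (∀ {i j} → Edge (edgesOf Q) i j → Edge g i j) → (f : DRTree? n S → Fin n) →
          (∀ (R : DRTree n S) → DRTree.root₁ R ≡ f (tree R) ⊎ DRTree.root₂ R ≡ f (tree R)) →
          (∀ {x} → inSet S x → Path (delete g a) x (f Q))
  partPath (empty p) _ _ _ f _ sx = ⊥-elim (empty⇒ p sx)
  partPath {S} (tree R) TR na inc f fS sx =
    proj₁ (carryPath (inSet S) (λ e sy → let sz = TreeOn.edgeInS TR (TreeOn.symm TR e) in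
                               sz , delete-intro {g = g} {v = a} (inc e) (na sy) (na sz))
               sx (TreeOn.connect TR sx tgt))
    where
      tgt : inSet S (f (tree R))
      tgt with fS R
      ... | inj₁ e = subst (inSet S) e (root₁-inSet R)
      ... | inj₂ e = subst (inSet S) e (root₂-inSet R)

  edgeOf₁ : ∀ {i j} → Edge (edgesOf D') i j → Edge g i j
  edgeOf₁ e = toG (∨-introˡ (∨-introʳ {gD _ _} (attach₁-edgesOf D' a e)))

  edgeOf₂ : ∀ {i j} → Edge (edgesOf D'') i j → Edge g i j
  edgeOf₂ e = toG (∨-introʳ {gD _ _ ∨ attach₁ D' a _ _} (attach₂-edgesOf D'' a e))

  branchSet₁-recovers : ∀ x → branchSet g a r1 x ≡ lookup Y x
  branchSet₁-recovers x = bool-ext fw bw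
    where
      fw : branchSet g a r1 x ≡ true → inSet Y x
      fw h with branchSet-elim {g = g} h
      ... | xa , W with outerRoot₁-cases D' a
      ... | inj₁ e = ⊥-elim (¬pathToDeleted xa (subst (Path (delete g a) x) e W))
      ... | inj₂ yr = proj₂ (carryPath (inSet Y) (stay zero) yr (reversePath (delete-symmetric (TreeOn.symm Tg)) W))
      bw : inSet Y x → branchSet g a r1 x ≡ true
      bw yx = branchSet-intro (aY yx) (partPath D' TY aY edgeOf₁ (λ Q → outerRoot₁ Q a) (λ R → inj₁ refl) yx)

  branchSet₂-recovers : ∀ x → branchSet g a r2 x ≡ lookup Z x
  branchSet₂-recovers x = bool-ext fw bw
    where
      fw : branchSet g a r2 x ≡ true → inSet Z x
      fw h with branchSet-elim {g = g} h
      ... | xa , W with outerRoot₂-cases D'' a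
      ... | inj₁ e = ⊥-elim (¬pathToDeleted xa (subst (Path (delete g a) x) e W))
      ... | inj₂ zr = proj₂ (carryPath (inSet Z) (stay (suc zero)) zr (reversePath (delete-symmetric (TreeOn.symm Tg)) W))
      bw : inSet Z x → branchSet g a r2 x ≡ true
      bw zx = branchSet-intro (aZ zx) (partPath D'' TZ aZ edgeOf₂ (λ Q → outerRoot₂ Q a) (λ R → inj₂ refl) zx)

  coreSet-recovers : ∀ x → coreSet g a r1 r2 x ≡ lookup X x
  coreSet-recovers x rewrite branchSet₁-recovers x | branchSet₂-recovers x = bool-ext fw bw
    where
      fw : not (lookup Y x) ∧ not (lookup Z x) ≡ true → inSet X x
      fw h with ∧-elim {not (lookup Y x)} h | cov x
      ... | _ , _ | inj₁ p = p
      ... | p , _ | inj₂ (inj₁ q) = ⊥-elim (not-true⇒ p q)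
      ... | _ , p | inj₂ (inj₂ q) = ⊥-elim (not-true⇒ p q)
      bw : inSet X x → not (lookup Y x) ∧ not (lookup Z x) ≡ true
      bw p = ∧-intro (⇒not-true (dXY p)) (⇒not-true (dXZ p))

  restrict-recovers : ∀ (s : Fin n → Bool) (S : Subset n) (gS : Graph n) → (∀ x → s x ≡ lookup S x) →
          (∀ {i j} → Edge gS i j → inSet S i × inSet S j) → (∀ {i j} → Edge gS i j → Edge g i j) →
          (∀ {i j} → Edge g i j → inSet S i → inSet S j → Edge gS i j) → ∀ i j → restrict g s i j ≡ gS i j
  restrict-recovers s S gS h edgeInS inc back i j = bool-ext fw bw
    where
      fw : restrict g s i j ≡ true → gS i j ≡ true
      fw r with restrict-elim {g = g} {s = s} ⟨ r ⟩
      ... | e , si , sj = holds (back e (trans (sym (h i)) si) (trans (sym (h j)) sj))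
      bw : gS i j ≡ true → restrict g s i j ≡ true
      bw e with edgeInS ⟨ e ⟩
      ... | mi , mj = holds (restrict-intro {g = g} {s = s} (inc ⟨ e ⟩) (trans (h i) mi) (trans (h j) mj))

  coreEdges-recover : toAdj (restrict g (coreSet g a r1 r2)) ≡ DRTree.edges D
  coreEdges-recover = toAdj-ext _ _ (restrict-recovers (coreSet g a r1 r2) X gD coreSet-recovers
               (λ e → TreeOn.edgeInS TD e , TreeOn.edgeInS TD (TreeOn.symm TD e))
               (λ e → toG (∨-introˡ (∨-introˡ (holds e)))) back)
    where
      back : ∀ {i j} → Edge g i j → inSet X i → inSet X j → Edge gD i j
      back e xi xj with glued-edgeCases e
      ... | inj₁ x = x
      ... | inj₂ (inj₁ x) = ⊥-elim (dXY xi (proj₁ (edgesOf-inSet D' TY x)))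
      ... | inj₂ (inj₂ (inj₁ x)) = ⊥-elim (dXZ xi (proj₁ (edgesOf-inSet D'' TZ x)))
      ... | inj₂ (inj₂ (inj₂ (inj₁ (_ , inj₁ y)))) = ⊥-elim (dXY xj y)
      ... | inj₂ (inj₂ (inj₂ (inj₁ (_ , inj₂ z)))) = ⊥-elim (dXZ xj z)
      ... | inj₂ (inj₂ (inj₂ (inj₂ (_ , inj₁ y)))) = ⊥-elim (dXY xi y)
      ... | inj₂ (inj₂ (inj₂ (inj₂ (_ , inj₂ z)))) = ⊥-elim (dXZ xi z)

  branch₁Edges-recover : ∀ (R : DRTree n Y) → D' ≡ tree R → toAdj (restrict g (branchSet g a r1)) ≡ DRTree.edges R
  branch₁Edges-recover R refl = toAdj-ext _ _ (restrict-recovers (branchSet g a r1) Y (adj (DRTree.edges R)) branchSet₁-recovers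
               (λ e → TreeOn.edgeInS TY e , TreeOn.edgeInS TY (TreeOn.symm TY e)) edgeOf₁ back)
    where
      back : ∀ {i j} → Edge g i j → inSet Y i → inSet Y j → Edge (adj (DRTree.edges R)) i j
      back e yi yj with glued-edgeCases e
      ... | inj₁ x = ⊥-elim (dXY (TreeOn.edgeInS TD x) yi)
      ... | inj₂ (inj₁ x) = x
      ... | inj₂ (inj₂ (inj₁ x)) = ⊥-elim (dYZ yi (proj₁ (edgesOf-inSet D'' TZ x)))
      ... | inj₂ (inj₂ (inj₂ (inj₁ (p , _)))) = ⊥-elim (aY yi p)
      ... | inj₂ (inj₂ (inj₂ (inj₂ (p , _)))) = ⊥-elim (aY yj p)

  branch₂Edges-recover : ∀ (R : DRTree n Z) → D'' ≡ tree R → toAdj (restrict g (branchSet g a r2)) ≡ DRTree.edges R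
  branch₂Edges-recover R refl = toAdj-ext _ _ (restrict-recovers (branchSet g a r2) Z (adj (DRTree.edges R)) branchSet₂-recovers
               (λ e → TreeOn.edgeInS TZ e , TreeOn.edgeInS TZ (TreeOn.symm TZ e)) edgeOf₂ back)
    where
      back : ∀ {i j} → Edge g i j → inSet Z i → inSet Z j → Edge (adj (DRTree.edges R)) i j
      back e zi zj with glued-edgeCases e
      ... | inj₁ x = ⊥-elim (dXZ (TreeOn.edgeInS TD x) zi)
      ... | inj₂ (inj₁ x) = ⊥-elim (dYZ (proj₁ (edgesOf-inSet D' TY x)) zi)
      ... | inj₂ (inj₂ (inj₁ x)) = x
      ... | inj₂ (inj₂ (inj₂ (inj₁ (p , _)))) = ⊥-elim (aZ zi p)
      ... | inj₂ (inj₂ (inj₂ (inj₂ (p , _)))) = ⊥-elim (aZ zj p)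

  neighbour₁-recovers : ∀ (R : DRTree n Y) → D' ≡ tree R → (ne : r1 ≢ a) →
        proj₁ (findNeighbour g Tg a r1 ne) ≡ DRTree.root₂ R
  neighbour₁-recovers R refl ne = TreeFacts.branchNeighbour-unique Tg (proj₁ (proj₂ F)) ed (proj₂ (proj₂ F)) wd
    where
      F : Σ (Fin n) (λ u → Edge g a u × Path (delete g a) u r1)
      F = findNeighbour g Tg a r1 ne
      d : Fin n
      d = DRTree.root₂ R
      ed : Edge g a d
      ed = toG (∨-introˡ (∨-introʳ {gD a d} (∨-introʳ {adj (DRTree.edges R) a d} (bridge-intro′ {s = d} {t = a}))))
      wd : Path (delete g a) d r1
      wd = partPath D' TY aY edgeOf₁ (λ Q → outerRoot₁ Q a) (λ R → inj₁ refl) (root₂-inSet R)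

  neighbour₂-recovers : ∀ (R : DRTree n Z) → D'' ≡ tree R → (ne : r2 ≢ a) →
        proj₁ (findNeighbour g Tg a r2 ne) ≡ DRTree.root₁ R
  neighbour₂-recovers R refl ne = TreeFacts.branchNeighbour-unique Tg (proj₁ (proj₂ F)) ed (proj₂ (proj₂ F)) wd
    where
      F : Σ (Fin n) (λ u → Edge g a u × Path (delete g a) u r2)
      F = findNeighbour g Tg a r2 ne
      e : Fin n
      e = DRTree.root₁ R
      ed : Edge g a e
      ed = toG (∨-introʳ {gD a e ∨ attach₁ D' a a e} (∨-introʳ {adj (DRTree.edges R) a e} (bridge-intro {s = a} {t = e})))
      wd : Path (delete g a) e r2
      wd = partPath D'' TZ aZ edgeOf₂ (λ Q → outerRoot₂ Q a) (λ R → inj₂ refl) (root₁-inSet R)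

module _ {n : ℕ} where

  QTriple-ext : ∀ {X X' Y Y' Z Z' : Subset n}
    .{a1 : X ∩ Y ≡ EmptySet} .{a2 : X ∩ Z ≡ EmptySet} .{a3 : Y ∩ Z ≡ EmptySet} .{a4 : X ∪ (Y ∪ Z) ≡ FullSet} .{a5 : Nonempty X}
    .{b1 : X' ∩ Y' ≡ EmptySet} .{b2 : X' ∩ Z' ≡ EmptySet} .{b3 : Y' ∩ Z' ≡ EmptySet} .{b4 : X' ∪ (Y' ∪ Z') ≡ FullSet} .{b5 : Nonempty X'}
    {D : DRTree n X} {D1 : DRTree n X'} {R : DRTree? n Y} {R1 : DRTree? n Y'} {F : DRTree? n Z} {F1 : DRTree? n Z'}
    (eX : X ≡ X') (eY : Y ≡ Y') (eZ : Z ≡ Z') →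
    subst (DRTree n) eX D ≡ D1 → subst (DRTree? n) eY R ≡ R1 → subst (DRTree? n) eZ F ≡ F1 →
    _≡_ {A = QTriple n}
      (record { X = X ; Y = Y ; Z = Z ; disjXY = a1 ; disjXZ = a2 ; disjYZ = a3 ; cover = a4 ; Xne = a5 ; D = D ; D′ = R ; D″ = F })
      (record { X = X' ; Y = Y' ; Z = Z' ; disjXY = b1 ; disjXZ = b2 ; disjYZ = b3 ; cover = b4 ; Xne = b5 ; D = D1 ; D′ = R1 ; D″ = F1 })
  QTriple-ext refl refl refl refl refl refl = refl

  DRTree-ext : ∀ {S S' : Subset n} (e : S ≡ S') (R : DRTree n S) (Q : DRTree n S') →
          DRTree.edges R ≡ DRTree.edges Q → DRTree.root₁ R ≡ DRTree.root₁ Q → DRTree.root₂ R ≡ DRTree.root₂ Q →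
          subst (DRTree n) e R ≡ Q
  DRTree-ext refl record {} record {} refl refl refl = refl

  tree-ext : ∀ {S S' : Subset n} (e : S ≡ S') {R : DRTree n S} {Q : DRTree n S'} →
          DRTree.edges R ≡ DRTree.edges Q → DRTree.root₁ R ≡ DRTree.root₁ Q → DRTree.root₂ R ≡ DRTree.root₂ Q →
          subst (DRTree? n) e (tree R) ≡ tree Q
  tree-ext refl {R} {Q} a b c = cong tree (DRTree-ext refl R Q a b c)

  empty-ext : ∀ {S S' : Subset n} (e : S ≡ S') .{p : S ≡ EmptySet} .{p' : S' ≡ EmptySet} →
             subst (DRTree? n) e (empty p) ≡ empty p'
  empty-ext refl = refl

  gluedRoots : ∀ {X Y Z : Subset n} → DRTree n X → DRTree? n Y → DRTree? n Z → Fin 3 → Fin n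
  gluedRoots D D' D'' = triple (outerRoot₁ D' (DRTree.root₁ D)) (outerRoot₂ D'' (DRTree.root₁ D)) (DRTree.root₂ D)

  cutBranch₁-glue : ∀ {X Y Z : Subset n} .(dxy : X ∩ Y ≡ EmptySet) .(dxz : X ∩ Z ≡ EmptySet) .(dyz : Y ∩ Z ≡ EmptySet)
    .(cv : X ∪ (Y ∪ Z) ≡ FullSet) (D : DRTree n X) (D' : DRTree? n Y) (D'' : DRTree? n Z)
    .(it : IsTree FullSet (gluedAdj D D' D''))
    .(m : MedianDef.IsMedian (adj (gluedAdj D D' D'')) (gluedRoots D D' D'') (DRTree.root₁ D))
    (eY : toSubset (branchSet (adj (gluedAdj D D' D'')) (DRTree.root₁ D) (outerRoot₁ D' (DRTree.root₁ D))) ≡ Y) →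
    subst (DRTree? n) eY (cutBranch₁ (gluedAdj D D' D'') it (gluedRoots D D' D'') (DRTree.root₁ D) m
                            (outerRoot₁ D' (DRTree.root₁ D) ≟ DRTree.root₁ D)) ≡ D'
  cutBranch₁-glue dxy dxz dyz cv D (empty p) D'' it m eY with DRTree.root₁ D ≟ DRTree.root₁ D
  ... | yes _ = empty-ext eY
  ... | no ne = ⊥-elim (ne refl)
  cutBranch₁-glue {Y = Y} dxy dxz dyz cv D (tree R) D'' it m eY with DRTree.root₁ R ≟ DRTree.root₁ D
  ... | yes e = ⊥-elim (disjoint⇒ dxy (root₁-inSet D) (subst (inSet Y) e (root₁-inSet R)))
  ... | no ne = tree-ext eY (G.branch₁Edges-recover R refl) refl (G.neighbour₁-recovers R refl ne)
    where module G = CutAfterGlue D (tree R) D'' (disjoint⇒ dxy) (disjoint⇒ dxz) (disjoint⇒ dyz) (cover⇒ cv)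

  cutBranch₂-glue : ∀ {X Y Z : Subset n} .(dxy : X ∩ Y ≡ EmptySet) .(dxz : X ∩ Z ≡ EmptySet) .(dyz : Y ∩ Z ≡ EmptySet)
    .(cv : X ∪ (Y ∪ Z) ≡ FullSet) (D : DRTree n X) (D' : DRTree? n Y) (D'' : DRTree? n Z)
    .(it : IsTree FullSet (gluedAdj D D' D''))
    .(m : MedianDef.IsMedian (adj (gluedAdj D D' D'')) (gluedRoots D D' D'') (DRTree.root₁ D))
    (eZ : toSubset (branchSet (adj (gluedAdj D D' D'')) (DRTree.root₁ D) (outerRoot₂ D'' (DRTree.root₁ D))) ≡ Z) →
    subst (DRTree? n) eZ (cutBranch₂ (gluedAdj D D' D'') it (gluedRoots D D' D'') (DRTree.root₁ D) m
                            (outerRoot₂ D'' (DRTree.root₁ D) ≟ DRTree.root₁ D)) ≡ D''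
  cutBranch₂-glue dxy dxz dyz cv D D' (empty p) it m eZ with DRTree.root₁ D ≟ DRTree.root₁ D
  ... | yes _ = empty-ext eZ
  ... | no ne = ⊥-elim (ne refl)
  cutBranch₂-glue {Z = Z} dxy dxz dyz cv D D' (tree R) it m eZ with DRTree.root₂ R ≟ DRTree.root₁ D
  ... | yes e = ⊥-elim (disjoint⇒ dxz (root₁-inSet D) (subst (inSet Z) e (root₂-inSet R)))
  ... | no ne = tree-ext eZ (G.branch₂Edges-recover R refl) (G.neighbour₂-recovers R refl ne) refl
    where module G = CutAfterGlue D D' (tree R) (disjoint⇒ dxy) (disjoint⇒ dxz) (disjoint⇒ dyz) (cover⇒ cv)

  cut-glue-at : ∀ {X Y Z : Subset n} .(dxy : X ∩ Y ≡ EmptySet) .(dxz : X ∩ Z ≡ EmptySet) .(dyz : Y ∩ Z ≡ EmptySet)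
    .(cv : X ∪ (Y ∪ Z) ≡ FullSet) .(xne : Nonempty X) (D : DRTree n X) (D' : DRTree? n Y) (D'' : DRTree? n Z)
    .(it : IsTree FullSet (gluedAdj D D' D'')) (v : Fin n)
    .(m : MedianDef.IsMedian (adj (gluedAdj D D' D'')) (gluedRoots D D' D'') v) → v ≡ DRTree.root₁ D →
    cutAt (gluedAdj D D' D'') it (gluedRoots D D' D'') v m ≡
    record { X = X ; Y = Y ; Z = Z ; disjXY = dxy ; disjXZ = dxz ; disjYZ = dyz ; cover = cv ; Xne = xne
           ; D = D ; D′ = D' ; D″ = D'' }
  cut-glue-at {X} {Y} {Z} dxy dxz dyz cv xne D D' D'' it v m refl =
    QTriple-ext eX eY eZ (DRTree-ext eX _ D G.coreEdges-recover refl refl)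
      (cutBranch₁-glue dxy dxz dyz cv D D' D'' it m eY)
      (cutBranch₂-glue dxy dxz dyz cv D D' D'' it m eZ)
    where
      module G = CutAfterGlue D D' D'' (disjoint⇒ dxy) (disjoint⇒ dxz) (disjoint⇒ dyz) (cover⇒ cv)
      eX : toSubset (coreSet G.g G.a G.r1 G.r2) ≡ X
      eX = toSubset-ext _ X G.coreSet-recovers
      eY : toSubset (branchSet G.g G.a G.r1) ≡ Y
      eY = toSubset-ext _ Y G.branchSet₁-recovers
      eZ : toSubset (branchSet G.g G.a G.r2) ≡ Z
      eZ = toSubset-ext _ Z G.branchSet₂-recovers

  cut-glue : ∀ {X Y Z : Subset n} .(dxy : X ∩ Y ≡ EmptySet) .(dxz : X ∩ Z ≡ EmptySet) .(dyz : Y ∩ Z ≡ EmptySet)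
    .(cv : X ∪ (Y ∪ Z) ≡ FullSet) .(xne : Nonempty X) (D : DRTree n X) (D' : DRTree? n Y) (D'' : DRTree? n Z)
    .(it : IsTree FullSet (gluedAdj D D' D'')) →
    cut (glued D D' D'' it) ≡
    record { X = X ; Y = Y ; Z = Z ; disjXY = dxy ; disjXZ = dxz ; disjYZ = dyz ; cover = cv ; Xne = xne
           ; D = D ; D′ = D' ; D″ = D'' }
  cut-glue dxy dxz dyz cv xne D D' D'' it =
    cut-glue-at dxy dxz dyz cv xne D D' D'' it (proj₁ vm) (proj₂ vm) (G.median≡centre (proj₂ vm))
    where
      module G = CutAfterGlue D D' D'' (disjoint⇒ dxy) (disjoint⇒ dxz) (disjoint⇒ dyz) (cover⇒ cv)
      vm : Σ (Fin n) (MedianDef.IsMedian (adj (gluedAdj D D' D'')) (gluedRoots D D' D''))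
      vm = findMedian (adj (gluedAdj D D' D'')) (gluedRoots D D' D'') (fullTreeOn it)

  cut∘glue : ∀ (q : QTriple n) → cut (glueAll q) ≡ q
  cut∘glue record { disjXY = dxy ; disjXZ = dxz ; disjYZ = dyz ; cover = cv ; Xne = xne ; D = D ; D′ = D' ; D″ = D'' } =
    cut-glue dxy dxz dyz cv xne D D' D'' (glue-isTree D D' D'' dxy dxz dyz cv)

theorem2p1 : (n : ℕ) → 1 ≤ n → QTriple n ⤖ TRTree n
theorem2p1 n _ = ↔⇒⤖ (mk↔ₛ′ glueAll cut glue∘cut cut∘glue)
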